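{- Let $R$ be a computable infinite integral domain. Let $P_0$ be the set of polynomials over $R$ having a root in $R$, and let $P_1$ be the set of polynomials over $R$ having a root in $R\setminus\{0\}$ (i.e. a root all of whose coordinates are nonzero). If $P_0$ is $\Sigma^0_1$-complete, then $P_1$ is also $\Sigma^0_1$-complete.
   Context: A computable integral domain is a countable integral domain with a bijection $\phi:R\to\mathbb{N}$ such that the induced addition and multiplication on $\mathbb{N}$ are computable; polynomials (in any finite number of variables) over $R$ are coded by natural numbers via $\phi$. $A\subseteq\mathbb{N}$ is $\Sigma^0_1$ if $n\in A\iff\exists m\,(n,m)\in B$ for a computable $B$; $\Pi^0_1$ sets are complements of $\Sigma^0_1$ sets; $A$ is $\Sigma^0_1$-complete if $A\in\Sigma^0_1$ and $A\notin\Pi^0_1$. -}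

module Defs where

open import Level using (Level; _⊔_; 0ℓ) renaming (suc to lsuc)
open import Data.Nat using (ℕ; zero; suc; _<_)
import Data.Nat as N
open import Data.Fin using (Fin)
open import Data.Vec using (Vec; []; _∷_; lookup)
open import Data.List using (List; []; _∷_; map)
open import Data.Product using (Σ; ∃; _×_; _,_)
open import Data.Sum using (_⊎_)
open import Relation.Nullary using (¬_)
open import Relation.Binary.PropositionalEquality as ≡ using (_≡_)
open import Function.Bundles using (Func; Bijection; _⇔_)
open import Algebra.Bundles using (CommutativeRing)

data Code : ℕ → Set where
  Z    : ∀ {n} → Code n
  S    : Code 1
  π    : ∀ {n} → Fin n → Code n
  comp : ∀ {k n} → Code k → Vec (Code n) k → Code n
  prec : ∀ {n} → Code n → Code (suc (suc n)) → Code (suc n)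
  mu   : ∀ {n} → Code (suc n) → Code n

mutual
  data _[_]⇓_ : ∀ {n} → Code n → Vec ℕ n → ℕ → Set where
    Z⇓    : ∀ {n} {xs : Vec ℕ n} → Z [ xs ]⇓ 0
    S⇓    : ∀ {x} → S [ x ∷ [] ]⇓ suc x
    π⇓    : ∀ {n} {i : Fin n} {xs} → π i [ xs ]⇓ lookup xs i
    comp⇓ : ∀ {k n} {f : Code k} {gs : Vec (Code n) k} {xs ys z} →
            gs [ xs ]⇓* ys → f [ ys ]⇓ z → comp f gs [ xs ]⇓ z
    prec0⇓ : ∀ {n} {f : Code n} {g xs z} →
             f [ xs ]⇓ z → prec f g [ 0 ∷ xs ]⇓ z
    precS⇓ : ∀ {n} {f : Code n} {g xs y r z} →
             prec f g [ y ∷ xs ]⇓ r → g [ y ∷ r ∷ xs ]⇓ z →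
             prec f g [ suc y ∷ xs ]⇓ z
    mu⇓   : ∀ {n} {f : Code (suc n)} {xs y} →
            f [ y ∷ xs ]⇓ 0 →
            (∀ z → z < y → ∃ λ v → f [ z ∷ xs ]⇓ suc v) →
            mu f [ xs ]⇓ y

  data _[_]⇓*_ : ∀ {k n} → Vec (Code n) k → Vec ℕ n → Vec ℕ k → Set where
    []⇓ : ∀ {n} {xs : Vec ℕ n} → [] [ xs ]⇓* []
    ∷⇓  : ∀ {k n} {g : Code n} {gs : Vec (Code n) k} {xs y ys} →
          g [ xs ]⇓ y → gs [ xs ]⇓* ys → (g ∷ gs) [ xs ]⇓* (y ∷ ys)

Computable₂ : ∀ {a} → (ℕ → ℕ → Set a) → Set a
Computable₂ B = ∃ λ (e : Code 2) → ∀ n m →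
  (e [ n ∷ m ∷ [] ]⇓ 1 × B n m) ⊎ (e [ n ∷ m ∷ [] ]⇓ 0 × ¬ B n m)

Σ⁰₁ : ∀ {a} → (ℕ → Set a) → Set (lsuc a)
Σ⁰₁ {a} A = ∃ λ (B : ℕ → ℕ → Set a) → Computable₂ B × (∀ n → A n ⇔ (∃ λ m → B n m))

Π⁰₁ : ∀ {a} → (ℕ → Set a) → Set (lsuc a)
Π⁰₁ {a} A = ∃ λ (S : ℕ → Set a) → Σ⁰₁ S × (∀ n → A n ⇔ (¬ S n))

-- Σ⁰₁-complete (as defined in the paper): in Σ⁰₁ but not in Π⁰₁.
Σ⁰₁-complete : ∀ {a} → (ℕ → Set a) → Set (lsuc a)
Σ⁰₁-complete A = Σ⁰₁ A × ¬ Π⁰₁ A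

-- Coding of finite lists of naturals:  [] ↦ 0,  x ∷ xs ↦ 2^x (2·code xs + 1).
-- (a bijection List ℕ ↔ ℕ)

encList : List ℕ → ℕ
encList []       = 0
encList (x ∷ xs) = (2 N.^ x) N.* (2 N.* encList xs N.+ 1)

module _ {c ℓ : Level} (R : CommutativeRing c ℓ) where
  open CommutativeRing R

  IsIntegralDomain : Set (c ⊔ ℓ)
  IsIntegralDomain = (¬ (1# ≈ 0#)) × (∀ x y → x * y ≈ 0# → (x ≈ 0#) ⊎ (y ≈ 0#))

  Numbering : Set (c ⊔ ℓ)
  Numbering = Bijection setoid (≡.setoid ℕ)

  module _ (φ : Numbering) where
    private
      ⌜_⌝ : Carrier → ℕ
      ⌜ x ⌝ = Bijection.to φ x

    InducedOpsComputable : Set c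
    InducedOpsComputable =
      (∃ λ (e : Code 2) → ∀ x y → e [ ⌜ x ⌝ ∷ ⌜ y ⌝ ∷ [] ]⇓ ⌜ x + y ⌝) ×
      (∃ λ (e : Code 2) → ∀ x y → e [ ⌜ x ⌝ ∷ ⌜ y ⌝ ∷ [] ]⇓ ⌜ x * y ⌝)

    -- A polynomial in the variables x₀, x₁, … : a finite list of monomials,
    -- each given by a coefficient and an exponent list (e₀, …, e_{k-1})
    -- standing for  coeff · x₀^e₀ ⋯ x_{k-1}^e_{k-1}.
    Poly : Set c
    Poly = List (Carrier × List ℕ)

    encPoly : Poly → ℕ
    encPoly p = encList (map (λ { (a , es) → encList (⌜ a ⌝ ∷ es) }) p)

    pow : Carrier → ℕ → Carrier
    pow x zero    = 1#
    pow x (suc k) = x * pow x k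

    evalMono : (ℕ → Carrier) → ℕ → List ℕ → Carrier
    evalMono v i []       = 1#
    evalMono v i (k ∷ ks) = pow (v i) k * evalMono v (suc i) ks

    evalPoly : Poly → (ℕ → Carrier) → Carrier
    evalPoly []             v = 0#
    evalPoly ((a , es) ∷ p) v = a * evalMono v 0 es + evalPoly p v

    P₀ : ℕ → Set (c ⊔ ℓ)
    P₀ n = ∃ λ (p : Poly) → encPoly p ≡ n × ∃ λ (v : ℕ → Carrier) → evalPoly p v ≈ 0#

    P₁ : ℕ → Set (c ⊔ ℓ)
    P₁ n = ∃ λ (p : Poly) → encPoly p ≡ n ×
           ∃ λ (v : ℕ → Carrier) → (∀ i → ¬ (v i ≈ 0#)) × evalPoly p v ≈ 0#

-- P₁ is Σ⁰₁: a witness for n codes a list of values, and whether n codes a polynomial, no value is 0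
-- and the polynomial vanishes there is computable from n and the witness, since the ring operations
-- are computable on codes.  P₁ is not Π⁰₁, because P₀ many-one reduces to it: substituting
-- x_i := y_{2i} + y_{2i+1} gives a polynomial with a root all of whose coordinates are nonzero iff p
-- has a root, as every v is (v - c) + c for some c ∉ {0, v}, which exists because R is infinite.  The
-- code of the substituted polynomial is computed from that of p by expanding each (u + t)^k into 2^k
-- monomials without collecting terms.
module Submission where

open import Defs
open import Level using (Level)
open import Algebra.Bundles using (CommutativeRing)
open import Data.Nat using (ℕ; _<_)
open import Data.Product using (_×_; _,_)
open import Relation.Binary.PropositionalEquality using (_≡_)

module Computability where
  open import Data.Nat using (ℕ; zero; suc; _+_)
  open import Data.Fin using (Fin; zero; suc; _↑ʳ_)
  open import Data.Vec using (Vec; []; _∷_; lookup; tabulate; drop)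
  open import Data.Vec.Properties using (tabulate∘lookup)
  open import Data.Product using (Σ; _,_)
  open import Function using (_∘_)
  open import Relation.Binary.PropositionalEquality using (_≡_; sym; subst; _≗_)

  Fn : ℕ → Set
  Fn n = Vec ℕ n → ℕ

  Computable : ∀ {n} → Fn n → Set
  Computable {n} f = Σ (Code n) λ e → ∀ xs → e [ xs ]⇓ f xs

  Computable* : ∀ {n k} → (Vec ℕ n → Vec ℕ k) → Set
  Computable* {n} {k} F = Σ (Vec (Code n) k) λ es → ∀ xs → es [ xs ]⇓* F xs

  computable-≗ : ∀ {n} {f g : Fn n} → f ≗ g → Computable f → Computable g
  computable-≗ f≗g (e , run) = e , λ xs → subst (e [ xs ]⇓_) (f≗g xs) (run xs)

  computable*-≗ : ∀ {n k} {F G : Vec ℕ n → Vec ℕ k} → F ≗ G → Computable* F → Computable* G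
  computable*-≗ F≗G (es , run) = es , λ xs → subst (es [ xs ]⇓*_) (F≗G xs) (run xs)

  zero-computable : ∀ {n} → Computable {n} (λ _ → 0)
  zero-computable = Z , λ _ → Z⇓

  lookup-computable : ∀ {n} (i : Fin n) → Computable (λ xs → lookup xs i)
  lookup-computable i = π i , λ _ → π⇓

  x₀ : ∀ {n} → Computable {suc n} (λ xs → lookup xs zero)
  x₀ = lookup-computable zero

  x₁ : ∀ {n} → Computable {2 + n} (λ xs → lookup xs (suc zero))
  x₁ = lookup-computable (suc zero)

  x₂ : ∀ {n} → Computable {3 + n} (λ xs → lookup xs (suc (suc zero)))
  x₂ = lookup-computable (suc (suc zero))

  x₃ : ∀ {n} → Computable {4 + n} (λ xs → lookup xs (suc (suc (suc zero))))
  x₃ = lookup-computable (suc (suc (suc zero)))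

  []* : ∀ {n} → Computable* {n} (λ _ → [])
  []* = [] , λ _ → []⇓

  infixr 5 _∷*_
  _∷*_ : ∀ {n k} {f : Fn n} {F : Vec ℕ n → Vec ℕ k} →
         Computable f → Computable* F → Computable* (λ xs → f xs ∷ F xs)
  (e , run) ∷* (es , runs) = e ∷ es , λ xs → ∷⇓ (run xs) (runs xs)

  infixr 4 _∘*_
  _∘*_ : ∀ {n k} {f : Fn k} {F : Vec ℕ n → Vec ℕ k} →
         Computable f → Computable* F → Computable (f ∘ F)
  (e , run) ∘* (es , runs) = comp e es , λ xs → comp⇓ (runs xs) (run _)

  tabulate-computable* : ∀ {n k} (ρ : Fin k → Fin n) → Computable* (λ xs → tabulate (lookup xs ∘ ρ))
  tabulate-computable* {k = zero}  ρ = []*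
  tabulate-computable* {k = suc k} ρ = lookup-computable (ρ zero) ∷* tabulate-computable* (ρ ∘ suc)

  drop-computable* : ∀ {n} d → Computable* {d + n} (drop d)
  drop-computable* d = computable*-≗ (tabulate-↑ʳ d) (tabulate-computable* (d ↑ʳ_))
    where
    tabulate-↑ʳ : ∀ {n} d (xs : Vec ℕ (d + n)) → tabulate (lookup xs ∘ (d ↑ʳ_)) ≡ drop d xs
    tabulate-↑ʳ zero    xs       = tabulate∘lookup xs
    tabulate-↑ʳ (suc d) (x ∷ xs) = tabulate-↑ʳ d xs

  prec-computable : ∀ {n} {f : Fn n} {g : Fn (2 + n)} → Computable f → Computable g →
                    (h : Fn (suc n)) → (∀ xs → h (0 ∷ xs) ≡ f xs) →
                    (∀ y xs → h (suc y ∷ xs) ≡ g (y ∷ h (y ∷ xs) ∷ xs)) → Computable h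
  prec-computable (ef , runf) (eg , rung) h h-zero h-suc = prec ef eg , λ { (y ∷ xs) → run y xs }
    where
    run : ∀ y xs → prec ef eg [ y ∷ xs ]⇓ h (y ∷ xs)
    run zero    xs = subst (_ [ 0 ∷ xs ]⇓_) (sym (h-zero xs)) (prec0⇓ (runf xs))
    run (suc y) xs = subst (_ [ suc y ∷ xs ]⇓_) (sym (h-suc y xs)) (precS⇓ (run y xs) (rung _))

  -- Records rather than abbreviations, so that f can be inferred from a proof of its computability.
  record Computable¹ (f : ℕ → ℕ) : Set where
    constructor computable¹
    field uncurried¹ : Computable {1} (λ xs → f (lookup xs zero))

  record Computable² (f : ℕ → ℕ → ℕ) : Set where
    constructor computable²
    field uncurried² : Computable {2} (λ xs → f (lookup xs zero) (lookup xs (suc zero)))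

  record Computable³ (f : ℕ → ℕ → ℕ → ℕ) : Set where
    constructor computable³
    field uncurried³ : Computable {3} (λ xs → f (lookup xs zero) (lookup xs (suc zero)) (lookup xs (suc (suc zero))))

  open Computable² public

  call¹ : ∀ {n f} {g : Fn n} → Computable¹ f → Computable g → Computable (λ xs → f (g xs))
  call¹ (computable¹ c) cg = c ∘* cg ∷* []*

  call² : ∀ {n f} {g h : Fn n} → Computable² f → Computable g → Computable h →
          Computable (λ xs → f (g xs) (h xs))
  call² (computable² c) cg ch = c ∘* cg ∷* ch ∷* []*

  call³ : ∀ {n f} {g h k : Fn n} → Computable³ f → Computable g → Computable h → Computable k →
          Computable (λ xs → f (g xs) (h xs) (k xs))
  call³ (computable³ c) cg ch ck = c ∘* cg ∷* ch ∷* ck ∷* []*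

  suc-computable : Computable¹ suc
  suc-computable = computable¹ (S , λ { (x ∷ []) → S⇓ })

  const-computable : ∀ {n} k → Computable {n} (λ _ → k)
  const-computable zero    = zero-computable
  const-computable (suc k) = call¹ suc-computable (const-computable k)

module Arithmetic where
  open Computability
  open import Data.Nat
  open import Data.Nat.Properties
  open import Data.Fin using (zero; suc)
  open import Data.Vec using ([]; _∷_; lookup; head; tail; drop)
  open import Data.Sum using (inj₁; inj₂)
  open import Relation.Nullary using (contradiction)
  open import Relation.Binary.PropositionalEquality

  pred-computable : Computable¹ pred
  pred-computable = computable¹ (prec-computable zero-computable x₀ _ (λ _ → refl) (λ _ _ → refl))

  +-computable : Computable² _+_
  +-computable = computable² (prec-computable x₀ (call¹ suc-computable x₁) _ (λ _ → refl) (λ _ _ → refl))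

  *-computable : Computable² _*_
  *-computable = computable² (prec-computable zero-computable (call² +-computable x₂ x₁) _
                                               (λ _ → refl) (λ _ _ → refl))

  ∸-computable : Computable² _∸_
  ∸-computable = computable² (∸-flipped ∘* x₁ ∷* x₀ ∷* []*)
    where
    ∸-flipped : Computable {2} (λ xs → lookup xs (suc zero) ∸ lookup xs zero)
    ∸-flipped = prec-computable x₀ (call¹ pred-computable x₁) _ (λ _ → refl)
                  (λ { y (m ∷ []) → sym (pred[m∸n]≡m∸[1+n] m y) })

  ^-computable : Computable² _^_
  ^-computable = computable² (^-flipped ∘* x₁ ∷* x₀ ∷* []*)
    where
    ^-flipped : Computable {2} (λ xs → lookup xs (suc zero) ^ lookup xs zero)
    ^-flipped = prec-computable (const-computable 1) (call² *-computable x₂ x₁) _ (λ _ → refl) (λ _ _ → refl)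

  ∣-∣-computable : Computable² ∣_-_∣
  ∣-∣-computable = computable² (computable-≗ (λ { (m ∷ n ∷ []) → sym (∣m-n∣≡m∸n+n∸m m n) })
                                  (call² +-computable (call² ∸-computable x₀ x₁) (call² ∸-computable x₁ x₀)))
    where
    ∣m-n∣≡m∸n+n∸m : ∀ m n → ∣ m - n ∣ ≡ (m ∸ n) + (n ∸ m)
    ∣m-n∣≡m∸n+n∸m zero    n       = cong (_+ n) (sym (0∸n≡0 n))
    ∣m-n∣≡m∸n+n∸m (suc m) zero    = sym (+-identityʳ (suc m))
    ∣m-n∣≡m∸n+n∸m (suc m) (suc n) = ∣m-n∣≡m∸n+n∸m m n

  if-zero : ℕ → ℕ → ℕ → ℕ
  if-zero zero    a b = a
  if-zero (suc _) a b = b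

  if-zero-computable : Computable³ if-zero
  if-zero-computable = computable³ (prec-computable x₀ x₃ _ (λ _ → refl) (λ _ _ → refl))

  if-zero-≢0 : ∀ {n} a b → n ≢ 0 → if-zero n a b ≡ b
  if-zero-≢0 {zero}  a b n≢0 = contradiction refl n≢0
  if-zero-≢0 {suc n} a b n≢0 = refl

  is-zero : ℕ → ℕ
  is-zero zero    = 1
  is-zero (suc _) = 0

  is-zero-computable : Computable¹ is-zero
  is-zero-computable = computable¹ (prec-computable (const-computable 1) zero-computable _
                                                     (λ _ → refl) (λ _ _ → refl))

  is-zero-nonZero : ∀ n → NonZero (is-zero n) → n ≡ 0
  is-zero-nonZero zero    _         = refl
  is-zero-nonZero (suc n) is-zero≢0 = contradiction refl (≢-nonZero⁻¹ 0 {{is-zero≢0}})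

  is-zero-∣n-n∣ : ∀ n → is-zero ∣ n - n ∣ ≡ 1
  is-zero-∣n-n∣ n = cong is-zero (∣n-n∣≡0 n)

  is-zero-∣m-n∣ : ∀ {m n} → m ≢ n → is-zero ∣ m - n ∣ ≡ 0
  is-zero-∣m-n∣ {m} {n} m≢n with ∣ m - n ∣ in eq
  ... | zero  = contradiction (∣m-n∣≡0⇒m≡n eq) m≢n
  ... | suc _ = refl

  -- The least x < b with P x ≡ 0, and b if there is none.  Opaque because unfolding it during
  -- conversion checking is very slow; only the lemmas below are ever needed.
  opaque
    search : (ℕ → ℕ) → ℕ → ℕ
    search P zero    = zero
    search P (suc b) = if-zero (is-zero ∣ search P b - b ∣ * P b) (search P b) (suc b)

    search-computable : ∀ {n} {P : Fn (suc n)} → Computable P →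
                        Computable {suc n} (λ ys → search (λ x → P (x ∷ tail ys)) (head ys))
    search-computable {n} {P} cP = prec-computable zero-computable step _ (λ _ → refl) (λ _ _ → refl)
      where
      step : Computable {2 + n} λ ys →
               if-zero (is-zero ∣ lookup ys (suc zero) - lookup ys zero ∣ * P (lookup ys zero ∷ drop 2 ys))
                       (lookup ys (suc zero)) (suc (lookup ys zero))
      step = call³ if-zero-computable
               (call² *-computable (call¹ is-zero-computable (call² ∣-∣-computable x₁ x₀))
                                   (cP ∘* x₀ ∷* drop-computable* 2))
               x₁ (call¹ suc-computable x₀)

    search-none : ∀ P b → (∀ z → z < b → P z ≢ 0) → search P b ≡ b
    search-none P zero    _      = refl
    search-none P (suc b) nonzero
      rewrite search-none P b (λ z z<b → nonzero z (m<n⇒m<1+n z<b)) | is-zero-∣n-n∣ b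
      with P b | nonzero b ≤-refl
    ... | zero  | Pb≢0 = contradiction refl Pb≢0
    ... | suc _ | _    = refl

    search-least : ∀ P b x → x < b → P x ≡ 0 → (∀ z → z < x → P z ≢ 0) → search P b ≡ x
    search-least P (suc b) x x<1+b Px≡0 below with m<1+n⇒m<n∨m≡n x<1+b
    ... | inj₁ x<b  rewrite search-least P b x x<b Px≡0 below | is-zero-∣m-n∣ (<⇒≢ x<b) = refl
    ... | inj₂ refl rewrite search-none P x below | is-zero-∣n-n∣ x | Px≡0 = refl

  search-unique : ∀ P b x → x < b → P x ≡ 0 → (∀ z → P z ≡ 0 → z ≡ x) → search P b ≡ x
  search-unique P b x x<b Px≡0 unique =
    search-least P b x x<b Px≡0 (λ z z<x Pz≡0 → <⇒≢ z<x (unique z Pz≡0))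

module Unpairing (f : ℕ → ℕ → ℕ) (f-computable : Computability.Computable² f)
                 (f-injective : ∀ {x y x′ y′} → f x y ≡ f x′ y′ → x ≡ x′ × y ≡ y′)
                 (f-bound : ∀ x y → x < f x y × y < f x y) where
  open Computability
  open Arithmetic
  open import Data.Nat
  open import Data.Nat.Properties
  open import Data.Product using (proj₁; proj₂)
  open import Relation.Nullary using (yes; no; contradiction)
  open import Relation.Binary.PropositionalEquality

  -- the y with f x y ≡ n if there is one, and suc n otherwise
  partner : ℕ → ℕ → ℕ
  partner x n = search (λ y → ∣ f x y - n ∣) (suc n)

  -- the least x that has a partner
  unpair₁ : ℕ → ℕ
  unpair₁ n = search (λ x → is-zero ∣ partner x n - suc n ∣) (suc n)

  unpair₂ : ℕ → ℕ
  unpair₂ n = partner (unpair₁ n) n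

  partner-computable : Computable² partner
  partner-computable = computable² (search-computable (call² ∣-∣-computable (call² f-computable x₁ x₀) x₂)
                                     ∘* call¹ suc-computable x₁ ∷* x₀ ∷* x₁ ∷* []*)

  unpair₁-computable : Computable¹ unpair₁
  unpair₁-computable = computable¹ (search-computable
                         (call¹ is-zero-computable (call² ∣-∣-computable (call² partner-computable x₀ x₁)
                                                                       (call¹ suc-computable x₁)))
                         ∘* call¹ suc-computable x₀ ∷* x₀ ∷* []*)

  unpair₂-computable : Computable¹ unpair₂
  unpair₂-computable = computable¹ (call² partner-computable (call¹ unpair₁-computable x₀) x₀)

  partner-f : ∀ x y → partner x (f x y) ≡ y
  partner-f x y = search-unique _ _ y (m<n⇒m<1+n (proj₂ (f-bound x y))) (∣n-n∣≡0 (f x y))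
                    (λ z e → proj₂ (f-injective (∣m-n∣≡0⇒m≡n e)))

  partner-f-≢ : ∀ {x′ x} y → x′ ≢ x → partner x′ (f x y) ≡ suc (f x y)
  partner-f-≢ y x′≢x = search-none _ _ λ z _ e → x′≢x (proj₁ (f-injective (∣m-n∣≡0⇒m≡n e)))

  unpair₁-f : ∀ x y → unpair₁ (f x y) ≡ x
  unpair₁-f x y = search-unique _ _ x (m<n⇒m<1+n (proj₁ (f-bound x y))) has-partner unique
    where
    has-partner : is-zero ∣ partner x (f x y) - suc (f x y) ∣ ≡ 0
    has-partner rewrite partner-f x y = is-zero-∣m-n∣ (<⇒≢ (m<n⇒m<1+n (proj₂ (f-bound x y))))
    unique : ∀ z → is-zero ∣ partner z (f x y) - suc (f x y) ∣ ≡ 0 → z ≡ x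
    unique z e with z ≟ x
    ... | yes z≡x = z≡x
    ... | no  z≢x rewrite partner-f-≢ y z≢x | is-zero-∣n-n∣ (suc (f x y)) = contradiction e λ ()

  unpair₂-f : ∀ x y → unpair₂ (f x y) ≡ y
  unpair₂-f x y rewrite unpair₁-f x y = partner-f x y

module ListCode where
  open Computability
  open Arithmetic
  open import Data.Nat
  open import Data.Nat.Properties
  open import Data.Nat.Induction using (<-rec)
  open import Data.List using (List; []; _∷_; length; drop; applyUpTo)
  open import Data.List.Relation.Unary.All using (All; []; _∷_)
  open import Function using (_∘_)
  open import Data.List.Properties using (drop-all)
  open import Data.Product using (∃; ∃₂; _×_; _,_; proj₂)
  open import Data.Sum using (_⊎_; inj₁; inj₂)
  open import Relation.Nullary using (contradiction)
  open import Relation.Binary.PropositionalEquality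

  -- encList (x ∷ l) is consᶜ x (encList l) by definition
  consᶜ : ℕ → ℕ → ℕ
  consᶜ x y = 2 ^ x * (2 * y + 1)

  consᶜ-computable : Computable² consᶜ
  consᶜ-computable = computable²
    (call² *-computable (call² ^-computable (const-computable 2) x₀)
                        (call² +-computable (call² *-computable (const-computable 2) x₁) (const-computable 1)))

  consᶜ-zero : ∀ y → consᶜ 0 y ≡ suc (2 * y)
  consᶜ-zero y = trans (+-identityʳ (2 * y + 1)) (+-comm (2 * y) 1)

  consᶜ-suc : ∀ x y → consᶜ (suc x) y ≡ 2 * consᶜ x y
  consᶜ-suc x y = *-assoc 2 (2 ^ x) (2 * y + 1)

  consᶜ-injective : ∀ {x y x′ y′} → consᶜ x y ≡ consᶜ x′ y′ → x ≡ x′ × y ≡ y′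
  consᶜ-injective {zero} {y} {zero} {y′} e =
    refl , *-cancelˡ-≡ y y′ 2 (suc-injective (trans (sym (consᶜ-zero y)) (trans e (consᶜ-zero y′))))
  consᶜ-injective {zero} {y} {suc x′} {y′} e =
    contradiction (trans (sym (consᶜ-suc x′ y′)) (trans (sym e) (consᶜ-zero y))) (even≢odd (consᶜ x′ y′) y)
  consᶜ-injective {suc x} {y} {zero} {y′} e =
    contradiction (trans (sym (consᶜ-suc x y)) (trans e (consᶜ-zero y′))) (even≢odd (consᶜ x y) y′)
  consᶜ-injective {suc x} {y} {suc x′} {y′} e
    with refl , refl ← consᶜ-injective {x} {y} {x′} {y′}
                         (*-cancelˡ-≡ _ _ 2 (trans (sym (consᶜ-suc x y)) (trans e (consᶜ-suc x′ y′))))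
    = refl , refl

  n<2^n : ∀ n → n < 2 ^ n
  n<2^n zero    = z<s
  n<2^n (suc n) = ≤-<-trans (n<2^n n) (m<m+n (2 ^ n) (≤-trans (m^n>0 2 n) (m≤m+n (2 ^ n) 0)))

  consᶜ-bound : ∀ x y → x < consᶜ x y × y < consᶜ x y
  consᶜ-bound x y = <-≤-trans (n<2^n x) (m≤m*n (2 ^ x) (2 * y + 1) {{odd≢0}}) ,
                    ≤-trans y<2y+1 (m≤n*m (2 * y + 1) (2 ^ x) {{m^n≢0 2 x}})
    where
    y<2y+1 : y < 2 * y + 1
    y<2y+1 = subst (y <_) (+-comm 1 (2 * y)) (s≤s (m≤m+n y (y + 0)))
    odd≢0 : NonZero (2 * y + 1)
    odd≢0 = subst NonZero (+-comm 1 (2 * y)) _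

  consᶜ≢0 : ∀ x y → consᶜ x y ≢ 0
  consᶜ≢0 x y e = n≮0 (subst (y <_) e (proj₂ (consᶜ-bound x y)))

  even-or-odd : ∀ n → ∃ λ m → n ≡ 2 * m ⊎ n ≡ suc (2 * m)
  even-or-odd zero    = 0 , inj₁ refl
  even-or-odd (suc n) with even-or-odd n
  ... | m , inj₁ refl = m , inj₂ refl
  ... | m , inj₂ refl = suc m , inj₁ (cong suc (sym (+-suc m (m + 0))))

  zero-or-consᶜ : ∀ n → n ≡ 0 ⊎ ∃₂ λ x y → consᶜ x y ≡ n
  zero-or-consᶜ = <-rec _ step
    where
    step : ∀ n → (∀ {m} → m < n → m ≡ 0 ⊎ ∃₂ λ x y → consᶜ x y ≡ m) →
           n ≡ 0 ⊎ ∃₂ λ x y → consᶜ x y ≡ n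
    step n rec with even-or-odd n
    ... | m     , inj₂ refl = inj₂ (0 , m , consᶜ-zero m)
    ... | zero  , inj₁ refl = inj₁ refl
    ... | suc m , inj₁ refl with rec {suc m} (m<m+n (suc m) {suc m + 0} (s≤s z≤n))
    ...   | inj₁ ()
    ...   | inj₂ (x , y , e) = inj₂ (suc x , y , trans (consᶜ-suc x y) (cong (2 *_) e))

  encList-surjective : ∀ n → ∃ λ l → encList l ≡ n
  encList-surjective = <-rec _ step
    where
    step : ∀ n → (∀ {m} → m < n → ∃ λ l → encList l ≡ m) → ∃ λ l → encList l ≡ n
    step n rec with zero-or-consᶜ n
    ... | inj₁ refl = [] , refl
    ... | inj₂ (x , y , refl) with l , refl ← rec (proj₂ (consᶜ-bound x y)) = x ∷ l , refl

  encList-injective : ∀ {l l′} → encList l ≡ encList l′ → l ≡ l′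
  encList-injective {[]}    {[]}      e = refl
  encList-injective {[]}    {x ∷ l′} e = contradiction (sym e) (consᶜ≢0 x (encList l′))
  encList-injective {x ∷ l} {[]}      e = contradiction e (consᶜ≢0 x (encList l))
  encList-injective {x ∷ l} {x′ ∷ l′} e
    with refl , e′ ← consᶜ-injective {x} {encList l} {x′} {encList l′} e
    = cong (x ∷_) (encList-injective e′)

  open Unpairing consᶜ consᶜ-computable consᶜ-injective consᶜ-bound
    using (unpair₁; unpair₂; unpair₁-computable; unpair₂-computable; unpair₁-f; unpair₂-f)

  headᶜ : ℕ → ℕ
  headᶜ n = if-zero n 0 (unpair₁ n)

  tailᶜ : ℕ → ℕ
  tailᶜ n = if-zero n 0 (unpair₂ n)

  headᶜ-computable : Computable¹ headᶜ
  headᶜ-computable = computable¹ (call³ if-zero-computable x₀ (const-computable 0)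
                       (call¹ unpair₁-computable x₀))

  tailᶜ-computable : Computable¹ tailᶜ
  tailᶜ-computable = computable¹ (call³ if-zero-computable x₀ (const-computable 0)
                       (call¹ unpair₂-computable x₀))

  headᶜ-consᶜ : ∀ x y → headᶜ (consᶜ x y) ≡ x
  headᶜ-consᶜ x y = trans (if-zero-≢0 0 _ (consᶜ≢0 x y)) (unpair₁-f x y)

  tailᶜ-consᶜ : ∀ x y → tailᶜ (consᶜ x y) ≡ y
  tailᶜ-consᶜ x y = trans (if-zero-≢0 0 _ (consᶜ≢0 x y)) (unpair₂-f x y)

  dropᶜ : ℕ → ℕ → ℕ
  dropᶜ zero    n = n
  dropᶜ (suc i) n = tailᶜ (dropᶜ i n)

  dropᶜ-computable : Computable² dropᶜ
  dropᶜ-computable = computable² (prec-computable x₀ (call¹ tailᶜ-computable x₁) _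
                                                   (λ _ → refl) (λ _ _ → refl))

  dropᶜ-encList : ∀ i l → dropᶜ i (encList l) ≡ encList (drop i l)
  dropᶜ-encList zero    l = refl
  dropᶜ-encList (suc i) l = trans (cong tailᶜ (dropᶜ-encList i l)) (tailᶜ-drop i l)
    where
    tailᶜ-drop : ∀ i l → tailᶜ (encList (drop i l)) ≡ encList (drop (suc i) l)
    tailᶜ-drop zero    []      = refl
    tailᶜ-drop (suc i) []      = refl
    tailᶜ-drop zero    (x ∷ l) = tailᶜ-consᶜ x (encList l)
    tailᶜ-drop (suc i) (x ∷ l) = tailᶜ-drop i l

  infixl 6 _‼_
  _‼_ : List ℕ → ℕ → ℕ
  []      ‼ i     = 0
  (x ∷ l) ‼ zero  = x
  (x ∷ l) ‼ suc i = l ‼ i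

  drop-‼ : ∀ k (l : List ℕ) → k < length l → drop k l ≡ l ‼ k ∷ drop (suc k) l
  drop-‼ zero    (x ∷ l) _          = refl
  drop-‼ (suc k) (x ∷ l) (s≤s k<l) = drop-‼ k l k<l

  All-‼ : ∀ {P : ℕ → Set} {l i} → All P l → i < length l → P (l ‼ i)
  All-‼ {i = zero}  (p ∷ _)  _          = p
  All-‼ {i = suc i} (_ ∷ ps) (s≤s i<l) = All-‼ ps i<l

  applyUpTo-‼ : ∀ (f : ℕ → ℕ) {n i} → i < n → applyUpTo f n ‼ i ≡ f i
  applyUpTo-‼ f {suc n} {zero}  _          = refl
  applyUpTo-‼ f {suc n} {suc i} (s≤s i<n) = applyUpTo-‼ (f ∘ suc) i<n

  lookupᶜ : ℕ → ℕ → ℕ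
  lookupᶜ i n = headᶜ (dropᶜ i n)

  lookupᶜ-computable : Computable² lookupᶜ
  lookupᶜ-computable = computable² (call¹ headᶜ-computable (call² dropᶜ-computable x₀ x₁))

  lookupᶜ-encList : ∀ i l → lookupᶜ i (encList l) ≡ l ‼ i
  lookupᶜ-encList i l = trans (cong headᶜ (dropᶜ-encList i l)) (headᶜ-drop i l)
    where
    headᶜ-drop : ∀ i l → headᶜ (encList (drop i l)) ≡ l ‼ i
    headᶜ-drop zero    []      = refl
    headᶜ-drop (suc i) []      = refl
    headᶜ-drop zero    (x ∷ l) = headᶜ-consᶜ x (encList l)
    headᶜ-drop (suc i) (x ∷ l) = headᶜ-drop i l

  lengthᶜ : ℕ → ℕ
  lengthᶜ n = search (λ i → dropᶜ i n) (suc n)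

  lengthᶜ-computable : Computable¹ lengthᶜ
  lengthᶜ-computable = computable¹ (search-computable (call² dropᶜ-computable x₀ x₁)
                                      ∘* call¹ suc-computable x₀ ∷* x₀ ∷* []*)

  drop-nonempty : ∀ i (l : List ℕ) → i < length l → encList (drop i l) ≢ 0
  drop-nonempty zero    (x ∷ l) _          = consᶜ≢0 x (encList l)
  drop-nonempty (suc i) (x ∷ l) (s≤s i<l) = drop-nonempty i l i<l

  lengthᶜ-encList : ∀ l → lengthᶜ (encList l) ≡ length l
  lengthᶜ-encList l = search-least _ _ (length l) (s≤s (length≤encList l))
    (trans (dropᶜ-encList (length l) l) (cong encList (drop-all (length l) l ≤-refl)))
    (λ i i<l e → drop-nonempty i l i<l (trans (sym (dropᶜ-encList i l)) e))
    where
    length≤encList : ∀ l → length l ≤ encList l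
    length≤encList []      = z≤n
    length≤encList (x ∷ l) = ≤-trans (s≤s (length≤encList l)) (proj₂ (consᶜ-bound x (encList l)))

module Folds where
  open Computability
  open Arithmetic
  open ListCode
  open import Data.Nat
  open import Data.Nat.Properties
  open import Data.Fin using (zero; suc)
  open import Data.Vec using ([]; _∷_; lookup; drop)
  open import Data.List using (List; []; _∷_; length; map; foldr; _++_; concatMap)
  open import Data.List.Properties using (drop-all)
  open import Data.List.Relation.Unary.All using (All; []; _∷_)
  open import Data.Nat.ListAction using (product)
  import Data.List as List
  open import Relation.Binary.PropositionalEquality

  ifoldr : (ℕ → ℕ → ℕ → ℕ) → ℕ → ℕ → List ℕ → ℕ
  ifoldr g z i []      = z
  ifoldr g z i (x ∷ l) = g i x (ifoldr g z (suc i) l)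

  ifoldr-ignoring-index : ∀ (g : ℕ → ℕ → ℕ) z i l → ifoldr (λ _ → g) z i l ≡ foldr g z l
  ifoldr-ignoring-index g z i []      = refl
  ifoldr-ignoring-index g z i (x ∷ l) = cong (g x) (ifoldr-ignoring-index g z (suc i) l)

  module _ {n} (g : Fn (3 + n)) (z : Fn n) where

    -- The fold of the last j entries of the list coded by c: primitive recursion on j cannot shorten c itself.
    foldLast : Fn (2 + n)
    foldLast (zero  ∷ c ∷ xs) = z xs
    foldLast (suc j ∷ c ∷ xs) = g (k ∷ lookupᶜ k c ∷ foldLast (j ∷ c ∷ xs) ∷ xs)
      where k = lengthᶜ c ∸ suc j

    foldᶜ : Fn (suc n)
    foldᶜ (c ∷ xs) = foldLast (lengthᶜ c ∷ c ∷ xs)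

    foldᶜ-encList : ∀ l xs → foldᶜ (encList l ∷ xs) ≡ ifoldr (λ i x a → g (i ∷ x ∷ a ∷ xs)) (z xs) 0 l
    foldᶜ-encList l xs = begin
      foldLast (lengthᶜ (encList l) ∷ encList l ∷ xs)
        ≡⟨ cong (λ L → foldLast (L ∷ encList l ∷ xs)) (lengthᶜ-encList l) ⟩
      foldLast (length l ∷ encList l ∷ xs)
        ≡⟨ invariant (length l) ≤-refl ⟩
      ifoldr G (z xs) (length l ∸ length l) (List.drop (length l ∸ length l) l)
        ≡⟨ cong (λ k → ifoldr G (z xs) k (List.drop k l)) (n∸n≡0 (length l)) ⟩
      ifoldr G (z xs) 0 l ∎
      where
      open ≡-Reasoning
      G = λ i x a → g (i ∷ x ∷ a ∷ xs)
      L = length l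
      invariant : ∀ j → j ≤ L →
                  foldLast (j ∷ encList l ∷ xs) ≡ ifoldr G (z xs) (L ∸ j) (List.drop (L ∸ j) l)
      invariant zero    _   = cong (ifoldr G (z xs) L) (sym (drop-all L l ≤-refl))
      invariant (suc j) j<L
        rewrite lengthᶜ-encList l | lookupᶜ-encList (L ∸ suc j) l | invariant j (≤-trans (n≤1+n j) j<L)
              | drop-‼ (L ∸ suc j) l (∸-monoʳ-< {L} {suc j} {0} z<s j<L)
              | +-∸-assoc 1 j<L
        = refl

  foldᶜ-computable : ∀ {n} {g : Fn (3 + n)} {z : Fn n} → Computable g → Computable z → Computable (foldᶜ g z)
  foldᶜ-computable {n} {g} {z} cg cz =
    computable-≗ (λ { (c ∷ xs) → refl })
                 (foldLast-computable ∘* call¹ lengthᶜ-computable x₀ ∷* x₀ ∷* drop-computable* 1)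
    where
    index = call² ∸-computable (call¹ lengthᶜ-computable x₂) (call¹ suc-computable x₀)
    foldLast-computable : Computable (foldLast g z)
    foldLast-computable = prec-computable (cz ∘* drop-computable* 1)
                            (cg ∘* index ∷* call² lookupᶜ-computable index x₂ ∷* x₁ ∷* drop-computable* 3)
                            _ (λ { (c ∷ xs) → refl }) (λ { y (c ∷ xs) → refl })

  appendᶜ : ℕ → ℕ → ℕ
  appendᶜ a b = foldᶜ (λ ys → consᶜ (lookup ys (suc zero)) (lookup ys (suc (suc zero))))
                      (λ ys → lookup ys zero) (a ∷ b ∷ [])

  appendᶜ-computable : Computable² appendᶜ
  appendᶜ-computable = computable² (computable-≗ (λ { (a ∷ b ∷ []) → refl })
                                     (foldᶜ-computable (call² consᶜ-computable x₁ x₂) x₀))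

  appendᶜ-encList : ∀ l l′ → appendᶜ (encList l) (encList l′) ≡ encList (l ++ l′)
  appendᶜ-encList l l′ =
    trans (foldᶜ-encList _ _ l (encList l′ ∷ [])) (trans (ifoldr-ignoring-index consᶜ _ 0 l) (foldr-consᶜ l))
    where
    foldr-consᶜ : ∀ l → foldr consᶜ (encList l′) l ≡ encList (l ++ l′)
    foldr-consᶜ []      = refl
    foldr-consᶜ (x ∷ l) = cong (consᶜ x) (foldr-consᶜ l)

  module _ {n} (F : Fn (suc n)) where

    mapᶜ : Fn (suc n)
    mapᶜ = foldᶜ (λ ys → consᶜ (F (lookup ys (suc zero) ∷ drop 3 ys)) (lookup ys (suc (suc zero)))) (λ _ → 0)

    mapᶜ-computable : Computable F → Computable mapᶜ
    mapᶜ-computable cF =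
      foldᶜ-computable (call² consᶜ-computable (cF ∘* x₁ ∷* drop-computable* 3) x₂) zero-computable

    mapᶜ-encList : ∀ {a} {A : Set a} (code : A → ℕ) (G : A → ℕ) xs (as : List A) →
                   (∀ a → F (code a ∷ xs) ≡ G a) → mapᶜ (encList (map code as) ∷ xs) ≡ encList (map G as)
    mapᶜ-encList code G xs as F∘code≗G =
      trans (foldᶜ-encList _ _ (map code as) xs) (trans (ifoldr-ignoring-index _ 0 0 (map code as)) (foldr-map as))
      where
      foldr-map : ∀ as → foldr (λ x acc → consᶜ (F (x ∷ xs)) acc) 0 (map code as) ≡ encList (map G as)
      foldr-map []       = refl
      foldr-map (a ∷ as) = cong₂ consᶜ (F∘code≗G a) (foldr-map as)

    concatMapᶜ : Fn (suc n)
    concatMapᶜ = foldᶜ (λ ys → appendᶜ (F (lookup ys (suc zero) ∷ drop 3 ys)) (lookup ys (suc (suc zero))))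
                       (λ _ → 0)

    concatMapᶜ-computable : Computable F → Computable concatMapᶜ
    concatMapᶜ-computable cF =
      foldᶜ-computable (call² appendᶜ-computable (cF ∘* x₁ ∷* drop-computable* 3) x₂) zero-computable

    concatMapᶜ-encList : ∀ {a} {A : Set a} (code : A → ℕ) (G : A → List ℕ) xs (as : List A) →
                         (∀ a → F (code a ∷ xs) ≡ encList (G a)) →
                         concatMapᶜ (encList (map code as) ∷ xs) ≡ encList (concatMap G as)
    concatMapᶜ-encList code G xs as F∘code≗G =
      trans (foldᶜ-encList _ _ (map code as) xs)
            (trans (ifoldr-ignoring-index _ 0 0 (map code as)) (foldr-concatMap as))
      where
      foldr-concatMap : ∀ as → foldr (λ x acc → appendᶜ (F (x ∷ xs)) acc) 0 (map code as)
                               ≡ encList (concatMap G as)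
      foldr-concatMap []       = refl
      foldr-concatMap (a ∷ as) =
        trans (cong₂ appendᶜ (F∘code≗G a) (foldr-concatMap as)) (appendᶜ-encList (G a) (concatMap G as))

    productᶜ : Fn (suc n)
    productᶜ = foldᶜ (λ ys → F (lookup ys (suc zero) ∷ drop 3 ys) * lookup ys (suc (suc zero))) (λ _ → 1)

    productᶜ-computable : Computable F → Computable productᶜ
    productᶜ-computable cF =
      foldᶜ-computable (call² *-computable (cF ∘* x₁ ∷* drop-computable* 3) x₂) (const-computable 1)

    productᶜ-encList : ∀ l xs → productᶜ (encList l ∷ xs) ≡ product (map (λ x → F (x ∷ xs)) l)
    productᶜ-encList l xs = trans (foldᶜ-encList _ _ l xs) (trans (ifoldr-ignoring-index _ 1 0 l) (foldr-map l))
      where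
      foldr-map : ∀ l → foldr (λ x acc → F (x ∷ xs) * acc) 1 l ≡ product (map (λ x → F (x ∷ xs)) l)
      foldr-map []      = refl
      foldr-map (x ∷ l) = cong (F (x ∷ xs) *_) (foldr-map l)

  product≢0⁻¹ : ∀ ns → .{{NonZero (product ns)}} → All NonZero ns
  product≢0⁻¹ []       = []
  product≢0⁻¹ (n ∷ ns) = m*n≢0⇒m≢0 n ∷ product≢0⁻¹ ns {{m*n≢0⇒n≢0 n}}

module ArithmeticalHierarchy where
  open Computability
  open Arithmetic
  open import Level using (Lift; lift)
  open import Data.Nat using (ℕ; zero; suc; NonZero)
  open import Data.Vec using ([]; _∷_)
  open import Data.Product using (∃; _×_; _,_; proj₁; proj₂)
  open import Data.Sum using (_⊎_; inj₁; inj₂)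
  open import Function using (_∘_)
  open import Function.Bundles using (_⇔_; mk⇔; Equivalence)
  open import Function.Properties.Equivalence using () renaming (trans to ⇔-trans)
  open import Relation.Nullary using (¬_)

  Σ⁰₁-by-checker : ∀ {a} {A : ℕ → Set a} {g : ℕ → ℕ → ℕ} → Computable² g →
                   (∀ n → A n ⇔ ∃ λ m → NonZero (g n m)) → Σ⁰₁ A
  Σ⁰₁-by-checker {a} {A} {g} g-computable A⇔∃g = B , (proj₁ χ , decide) , A⇔∃B
    where
    B : ℕ → ℕ → Set a
    B n m = Lift a (NonZero (g n m))
    χ = call¹ is-zero-computable (call¹ is-zero-computable (uncurried² g-computable))
    run : ∀ n m → proj₁ χ [ n ∷ m ∷ [] ]⇓ is-zero (is-zero (g n m))
    run n m = proj₂ χ (n ∷ m ∷ [])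
    decide : ∀ n m → (proj₁ χ [ n ∷ m ∷ [] ]⇓ 1 × B n m) ⊎ (proj₁ χ [ n ∷ m ∷ [] ]⇓ 0 × ¬ B n m)
    decide n m with g n m | run n m
    ... | zero  | χ⇓ = inj₂ (χ⇓ , λ ())
    ... | suc _ | χ⇓ = inj₁ (χ⇓ , _)
    A⇔∃B : ∀ n → A n ⇔ ∃ (B n)
    A⇔∃B n = mk⇔ (λ An → let m , g≢0 = Equivalence.to (A⇔∃g n) An in m , lift g≢0)
                 (λ { (m , lift g≢0) → Equivalence.from (A⇔∃g n) (m , g≢0) })

  Computable₂-∘ : ∀ {a} {B : ℕ → ℕ → Set a} {f : ℕ → ℕ} → Computable¹ f → Computable₂ B →
                  Computable₂ (λ n m → B (f n) m)
  Computable₂-∘ {f = f} f-computable (e , decide) = comp e (proj₁ arguments) , decide∘f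
    where
    arguments = call¹ f-computable x₀ ∷* x₁ ∷* []*
    decide∘f : ∀ n m → _
    decide∘f n m with decide (f n) m
    ... | inj₁ (e⇓ , b)  = inj₁ (comp⇓ (proj₂ arguments (n ∷ m ∷ [])) e⇓ , b)
    ... | inj₂ (e⇓ , ¬b) = inj₂ (comp⇓ (proj₂ arguments (n ∷ m ∷ [])) e⇓ , ¬b)

  Π⁰₁-reduce : ∀ {a} {A B : ℕ → Set a} {f : ℕ → ℕ} → Computable¹ f →
               (∀ n → A n ⇔ B (f n)) → Π⁰₁ B → Π⁰₁ A
  Π⁰₁-reduce {f = f} f-computable A⇔B∘f (Q , (C , C-computable , Q⇔∃C) , B⇔¬Q) =
    Q ∘ f , ((λ n m → C (f n) m) , Computable₂-∘ f-computable C-computable , Q⇔∃C ∘ f) ,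
    λ n → ⇔-trans (A⇔B∘f n) (B⇔¬Q (f n))

module PolynomialCodes {c ℓ : Level} (R : CommutativeRing c ℓ) (φ : Numbering R) where
  open CommutativeRing R hiding (zero) renaming (refl to ≈-refl; sym to ≈-sym; trans to ≈-trans)
  open Computability
  open ListCode
  open Folds
  open import Data.Nat as ℕ using (ℕ; zero; suc; NonZero; _<_; s≤s)
  open import Data.Nat.Properties using (<-≤-trans; m≤m⊔n; m≤n⊔m; +-suc; m≤m+n)
  open import Data.List using (List; []; _∷_; length; map)
  open import Data.List.Properties using (∷-injective; map-id)
  open import Data.Nat.ListAction using (product)
  open import Data.Nat.ListAction.Properties using (product≢0)
  open import Data.Fin using (zero)
  open import Data.Vec using ([]; _∷_; lookup)
  open import Data.List.Relation.Unary.All using (All; []; _∷_)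
  open import Data.Product using (∃; _×_; _,_)
  open import Data.Sum using (inj₁; inj₂)
  open import Function using (_∘_)
  open import Function.Bundles using (Bijection; Surjection)
  open import Relation.Nullary using (contradiction)
  open import Relation.Binary.PropositionalEquality as ≡ using (_≡_)

  infix 10 ⟦_⟧_
  ⟦_⟧_ : Poly R φ → (ℕ → Carrier) → Carrier
  ⟦ p ⟧ v = evalPoly R φ p v

  ⌜_⌝ : Carrier → ℕ
  ⌜_⌝ = Bijection.to φ

  ⌞_⌟ : ℕ → Carrier
  ⌞_⌟ = Bijection.to⁻ φ

  ⌜⌞⌟⌝ : ∀ k → ⌜ ⌞ k ⌟ ⌝ ≡ k
  ⌜⌞⌟⌝ = Surjection.to∘to⁻ (Bijection.surjection φ)

  ⌜⌝-cong : ∀ {x y} → x ≈ y → ⌜ x ⌝ ≡ ⌜ y ⌝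
  ⌜⌝-cong = Bijection.cong φ

  ⌜⌝-injective : ∀ {x y} → ⌜ x ⌝ ≡ ⌜ y ⌝ → x ≈ y
  ⌜⌝-injective = Bijection.injective φ

  ⌞⌜⌝⌟ : ∀ x → ⌞ ⌜ x ⌝ ⌟ ≈ x
  ⌞⌜⌝⌟ x = ⌜⌝-injective (⌜⌞⌟⌝ ⌜ x ⌝)

  monomialCode : Carrier × List ℕ → ℕ
  monomialCode (a , es) = encList (⌜ a ⌝ ∷ es)

  encPoly-encList : ∀ p → encPoly R φ p ≡ encList (map monomialCode p)
  encPoly-encList []            = ≡.refl
  encPoly-encList ((a , es) ∷ p) = ≡.cong (consᶜ (monomialCode (a , es))) (encPoly-encList p)

  monomialCodes-nonZero : ∀ p → All NonZero (map monomialCode p)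
  monomialCodes-nonZero []             = []
  monomialCodes-nonZero ((a , es) ∷ p) = ℕ.≢-nonZero (consᶜ≢0 ⌜ a ⌝ (encList es)) ∷ monomialCodes-nonZero p

  encPoly-onto : ∀ l → All NonZero l → ∃ λ p → encPoly R φ p ≡ encList l
  encPoly-onto []      []              = [] , ≡.refl
  encPoly-onto (x ∷ l) (x≢0 ∷ l≢0) with zero-or-consᶜ x | encPoly-onto l l≢0
  ... | inj₁ ≡.refl             | _ = contradiction ≡.refl (ℕ.≢-nonZero⁻¹ 0 {{x≢0}})
  ... | inj₂ (a , y , ≡.refl) | p , p-code with es , ≡.refl ← encList-surjective y =
    (⌞ a ⌟ , es) ∷ p , ≡.cong₂ consᶜ (≡.cong (λ a′ → consᶜ a′ (encList es)) (⌜⌞⌟⌝ a)) p-code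

  ⟦⟧-encPoly : ∀ p q v → encPoly R φ p ≡ encPoly R φ q → ⟦ p ⟧ v ≈ ⟦ q ⟧ v
  ⟦⟧-encPoly p q v same-code =
    same-monomials p q
      (encList-injective (≡.trans (≡.sym (encPoly-encList p)) (≡.trans same-code (encPoly-encList q))))
    where
    same-monomials : ∀ p q → map monomialCode p ≡ map monomialCode q → ⟦ p ⟧ v ≈ ⟦ q ⟧ v
    same-monomials []             []               _ = ≈-refl
    same-monomials ((a , es) ∷ p) ((b , es′) ∷ q) e
      with same-monomial , same-rest ← ∷-injective e
      with ⌜a⌝≡⌜b⌝ , ≡.refl ← ∷-injective (encList-injective {⌜ a ⌝ ∷ es} {⌜ b ⌝ ∷ es′} same-monomial)
      = +-cong (*-cong (⌜⌝-injective ⌜a⌝≡⌜b⌝) ≈-refl) (same-monomials p q same-rest)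

  -- nonzero exactly on codes of lists of nonzero numbers, that is, of polynomials
  isPolyᶜ : ℕ → ℕ
  isPolyᶜ n = productᶜ (λ ys → lookup ys zero) (n ∷ [])

  isPolyᶜ-computable : Computable¹ isPolyᶜ
  isPolyᶜ-computable = computable¹ (computable-≗ (λ { (n ∷ []) → ≡.refl })
                                     (productᶜ-computable (λ ys → lookup ys zero) x₀))

  isPolyᶜ-encList : ∀ l → isPolyᶜ (encList l) ≡ product l
  isPolyᶜ-encList l = ≡.trans (productᶜ-encList (λ ys → lookup ys zero) l []) (≡.cong product (map-id l))

  isPolyᶜ-encPoly : ∀ p → NonZero (isPolyᶜ (encPoly R φ p))
  isPolyᶜ-encPoly p =
    ≡.subst NonZero (≡.sym (≡.trans (≡.cong isPolyᶜ (encPoly-encList p)) (isPolyᶜ-encList (map monomialCode p))))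
            (product≢0 (monomialCodes-nonZero p))

  isPolyᶜ-nonZero : ∀ n → NonZero (isPolyᶜ n) → ∃ λ p → encPoly R φ p ≡ n
  isPolyᶜ-nonZero n isPoly with l , ≡.refl ← encList-surjective n =
    encPoly-onto l (product≢0⁻¹ l {{≡.subst NonZero (isPolyᶜ-encList l) isPoly}})

  pow-cong : ∀ {x y} k → x ≈ y → pow R φ x k ≈ pow R φ y k
  pow-cong zero    x≈y = ≈-refl
  pow-cong (suc k) x≈y = *-cong x≈y (pow-cong k x≈y)

  evalMono-local : ∀ v v′ j es → (∀ i → i < j ℕ.+ length es → v i ≈ v′ i) →
                   evalMono R φ v j es ≈ evalMono R φ v′ j es
  evalMono-local v v′ j []       agree = ≈-refl
  evalMono-local v v′ j (k ∷ es) agree =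
    *-cong (pow-cong k (agree j (below (s≤s (m≤m+n j _))))) (evalMono-local v v′ (suc j) es λ i → agree i ∘ below)
    where
    below : ∀ {i} → i < suc j ℕ.+ length es → i < j ℕ.+ length (k ∷ es)
    below {i} = ≡.subst (i <_) (≡.sym (+-suc j (length es)))

  arity : Poly R φ → ℕ
  arity []             = 0
  arity ((a , es) ∷ p) = length es ℕ.⊔ arity p

  ⟦⟧-local : ∀ p v v′ → (∀ i → i < arity p → v i ≈ v′ i) → ⟦ p ⟧ v ≈ ⟦ p ⟧ v′
  ⟦⟧-local []             v v′ agree = ≈-refl
  ⟦⟧-local ((a , es) ∷ p) v v′ agree =
    +-cong (*-cong ≈-refl (evalMono-local v v′ 0 es λ i i<l → agree i (<-≤-trans i<l (m≤m⊔n _ _))))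
           (⟦⟧-local p v v′ λ i i<arity → agree i (<-≤-trans i<arity (m≤n⊔m _ _)))

module PolynomialEvaluation {c ℓ : Level} (R : CommutativeRing c ℓ) (φ : Numbering R)
                            (ops : InducedOpsComputable R φ) where
  open CommutativeRing R hiding (zero) renaming (refl to ≈-refl; sym to ≈-sym; trans to ≈-trans)
  open Computability
  open Arithmetic
  open ListCode
  open Folds
  open PolynomialCodes R φ
  open import Data.Nat as ℕ using (ℕ; zero; suc; _<_; _≤_)
  open import Data.Fin using (zero; suc)
  open import Data.Vec using ([]; _∷_; lookup)
  open import Data.List using (List; []; _∷_; map; length)
  open import Data.List.Properties using (drop-all)
  open import Data.Product using (∃; _,_; proj₁; proj₂)
  open import Relation.Binary.PropositionalEquality as ≡ using (_≡_)

  onCodes : (Carrier → Carrier → Carrier) → ℕ → ℕ → ℕ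
  onCodes _∙_ a b = ⌜ ⌞ a ⌟ ∙ ⌞ b ⌟ ⌝

  onCodes-computable : ∀ {_∙_} → (∃ λ e → ∀ x y → e [ ⌜ x ⌝ ∷ ⌜ y ⌝ ∷ [] ]⇓ ⌜ x ∙ y ⌝) →
                       Computable² (onCodes _∙_)
  onCodes-computable {_∙_} (e , run) = computable² (e , λ { (a ∷ b ∷ []) →
    ≡.subst₂ (λ a′ b′ → e [ a′ ∷ b′ ∷ [] ]⇓ (onCodes _∙_ a b)) (⌜⌞⌟⌝ a) (⌜⌞⌟⌝ b) (run ⌞ a ⌟ ⌞ b ⌟) })

  onCodes-⌜⌝ : ∀ {_∙_} → (∀ {x x′ y y′} → x ≈ x′ → y ≈ y′ → (x ∙ y) ≈ (x′ ∙ y′)) →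
               ∀ x y → onCodes _∙_ ⌜ x ⌝ ⌜ y ⌝ ≡ ⌜ x ∙ y ⌝
  onCodes-⌜⌝ ∙-cong x y = ⌜⌝-cong (∙-cong (⌞⌜⌝⌟ x) (⌞⌜⌝⌟ y))

  addᶜ mulᶜ : ℕ → ℕ → ℕ
  addᶜ = onCodes _+_
  mulᶜ = onCodes _*_

  addᶜ-computable : Computable² addᶜ
  addᶜ-computable = onCodes-computable (proj₁ ops)

  mulᶜ-computable : Computable² mulᶜ
  mulᶜ-computable = onCodes-computable (proj₂ ops)

  powᶜ : ℕ → ℕ → ℕ
  powᶜ a k = ⌜ pow R φ ⌞ a ⌟ k ⌝

  powᶜ-computable : Computable² powᶜ
  powᶜ-computable = computable² (powᶜ-flipped ∘* x₁ ∷* x₀ ∷* []*)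
    where
    powᶜ-flipped : Computable {2} (λ xs → powᶜ (lookup xs (suc zero)) (lookup xs zero))
    powᶜ-flipped = prec-computable (const-computable ⌜ 1# ⌝) (call² mulᶜ-computable x₂ x₁) _ (λ _ → ≡.refl)
                     (λ { k (a ∷ []) → ⌜⌝-cong (*-cong ≈-refl (≈-sym (⌞⌜⌝⌟ _))) })

  -- entry i of the list coded by m, and the code of 1 past its end, so that unlisted variables are nonzero
  valueᶜ : ℕ → ℕ → ℕ
  valueᶜ i m = if-zero (dropᶜ i m) ⌜ 1# ⌝ (lookupᶜ i m)

  valueᶜ-computable : Computable² valueᶜ
  valueᶜ-computable = computable² (call³ if-zero-computable (call² dropᶜ-computable x₀ x₁)
                                     (const-computable ⌜ 1# ⌝) (call² lookupᶜ-computable x₀ x₁))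

  valueᶜ-< : ∀ l i → i < length l → valueᶜ i (encList l) ≡ l ‼ i
  valueᶜ-< l i i<l = ≡.trans (≡.cong (λ d → if-zero d ⌜ 1# ⌝ (lookupᶜ i (encList l))) (dropᶜ-encList i l))
                             (≡.trans (if-zero-≢0 ⌜ 1# ⌝ _ (drop-nonempty i l i<l)) (lookupᶜ-encList i l))

  valueᶜ-≥ : ∀ l i → length l ≤ i → valueᶜ i (encList l) ≡ ⌜ 1# ⌝
  valueᶜ-≥ l i l≤i = ≡.cong (λ d → if-zero d ⌜ 1# ⌝ (lookupᶜ i (encList l)))
                            (≡.trans (dropᶜ-encList i l) (≡.cong encList (drop-all i l l≤i)))

  assignment : ℕ → ℕ → Carrier
  assignment m i = ⌞ valueᶜ i m ⌟

  evalMonoᶜ : ℕ → ℕ → ℕ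
  evalMonoᶜ es m = foldᶜ (λ ys → mulᶜ (powᶜ (valueᶜ (lookup ys zero) (lookup ys (suc (suc (suc zero)))))
                                               (lookup ys (suc zero)))
                                        (lookup ys (suc (suc zero))))
                         (λ _ → ⌜ 1# ⌝) (es ∷ m ∷ [])

  evalMonoᶜ-computable : Computable² evalMonoᶜ
  evalMonoᶜ-computable = computable² (computable-≗ (λ { (es ∷ m ∷ []) → ≡.refl })
    (foldᶜ-computable (call² mulᶜ-computable (call² powᶜ-computable (call² valueᶜ-computable x₀ x₃) x₁) x₂)
                      (const-computable ⌜ 1# ⌝)))

  evalMonoᶜ-encList : ∀ es m → evalMonoᶜ (encList es) m ≡ ⌜ evalMono R φ (assignment m) 0 es ⌝
  evalMonoᶜ-encList es m = ≡.trans (foldᶜ-encList _ _ es (m ∷ [])) (ifoldr-evalMono 0 es)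
    where
    ifoldr-evalMono : ∀ j es → ifoldr (λ i e acc → mulᶜ (powᶜ (valueᶜ i m) e) acc) ⌜ 1# ⌝ j es
                               ≡ ⌜ evalMono R φ (assignment m) j es ⌝
    ifoldr-evalMono j []       = ≡.refl
    ifoldr-evalMono j (e ∷ es) = ≡.trans (≡.cong (mulᶜ _) (ifoldr-evalMono (suc j) es)) (onCodes-⌜⌝ *-cong _ _)

  evalPolyᶜ : ℕ → ℕ → ℕ
  evalPolyᶜ n m =
    foldᶜ (λ ys → addᶜ (mulᶜ (headᶜ (lookup ys (suc zero)))
                             (evalMonoᶜ (tailᶜ (lookup ys (suc zero))) (lookup ys (suc (suc (suc zero))))))
                       (lookup ys (suc (suc zero))))
          (λ _ → ⌜ 0# ⌝) (n ∷ m ∷ [])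

  evalPolyᶜ-computable : Computable² evalPolyᶜ
  evalPolyᶜ-computable = computable² (computable-≗ (λ { (n ∷ m ∷ []) → ≡.refl })
    (foldᶜ-computable (call² addᶜ-computable (call² mulᶜ-computable (call¹ headᶜ-computable x₁)
                                                 (call² evalMonoᶜ-computable (call¹ tailᶜ-computable x₁) x₃)) x₂)
                      (const-computable ⌜ 0# ⌝)))

  evalPolyᶜ-encPoly : ∀ p m → evalPolyᶜ (encPoly R φ p) m ≡ ⌜ ⟦ p ⟧ assignment m ⌝
  evalPolyᶜ-encPoly p m =
    ≡.trans (≡.cong (λ n → evalPolyᶜ n m) (encPoly-encList p))
            (≡.trans (foldᶜ-encList _ _ (map monomialCode p) (m ∷ [])) (ifoldr-evalPoly 0 p))
    where
    ifoldr-evalPoly : ∀ j p →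
      ifoldr (λ i mono acc → addᶜ (mulᶜ (headᶜ mono) (evalMonoᶜ (tailᶜ mono) m)) acc) ⌜ 0# ⌝ j (map monomialCode p)
      ≡ ⌜ ⟦ p ⟧ assignment m ⌝
    ifoldr-evalPoly j []             = ≡.refl
    ifoldr-evalPoly j ((a , es) ∷ p) =
      ≡.trans (≡.cong₂ addᶜ (monomial a es) (ifoldr-evalPoly (suc j) p)) (onCodes-⌜⌝ +-cong _ _)
      where
      monomial : ∀ a es → mulᶜ (headᶜ (monomialCode (a , es))) (evalMonoᶜ (tailᶜ (monomialCode (a , es))) m)
                          ≡ ⌜ a * evalMono R φ (assignment m) 0 es ⌝
      monomial a es
        rewrite headᶜ-consᶜ ⌜ a ⌝ (encList es) | tailᶜ-consᶜ ⌜ a ⌝ (encList es) | evalMonoᶜ-encList es m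
        = onCodes-⌜⌝ *-cong a _

module RootChecking {c ℓ : Level} (R : CommutativeRing c ℓ) (φ : Numbering R)
                    (ops : InducedOpsComputable R φ) where
  open CommutativeRing R hiding (zero) renaming (refl to ≈-refl; sym to ≈-sym; trans to ≈-trans)
  open Computability
  open Arithmetic
  open ListCode
  open Folds
  open ArithmeticalHierarchy
  open PolynomialCodes R φ
  open PolynomialEvaluation R φ ops
  open import Data.Nat as ℕ using (ℕ; zero; NonZero; ∣_-_∣; _<?_)
  open import Data.Nat.Properties using (m*n≢0; m*n≢0⇒m≢0; m*n≢0⇒n≢0; ∣m-n∣≡0⇒m≡n; ∣n-n∣≡0; ≮⇒≥)
  open import Data.Nat.ListAction.Properties using (product≢0)
  open import Data.Fin using (zero)
  open import Data.Vec using ([]; _∷_; lookup)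
  open import Data.List using (List; []; _∷_; map; applyUpTo; length)
  open import Data.List.Properties using (length-applyUpTo)
  open import Data.List.Relation.Unary.All using (All)
  open import Data.List.Relation.Unary.All.Properties using (map⁺; map⁻; applyUpTo⁺₂)
  open import Data.Product using (∃; _×_; _,_)
  open import Function using (_∘_)
  open import Function.Bundles using (_⇔_; mk⇔)
  open import Relation.Nullary using (¬_; yes; no)
  open import Relation.Binary.PropositionalEquality as ≡ using (_≡_)

  distanceFrom0ᶜ : Fn 1
  distanceFrom0ᶜ ys = ∣ lookup ys zero - ⌜ 0# ⌝ ∣

  allNonZeroᶜ : ℕ → ℕ
  allNonZeroᶜ m = productᶜ distanceFrom0ᶜ (m ∷ [])

  allNonZeroᶜ-computable : Computable¹ allNonZeroᶜ
  allNonZeroᶜ-computable = computable¹ (computable-≗ (λ { (m ∷ []) → ≡.refl })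
    (productᶜ-computable distanceFrom0ᶜ (call² ∣-∣-computable x₀ (const-computable ⌜ 0# ⌝))))

  allNonZeroᶜ-applyUpTo : ∀ (v : ℕ → Carrier) N → (∀ i → ¬ v i ≈ 0#) →
                          NonZero (allNonZeroᶜ (encList (applyUpTo (⌜_⌝ ∘ v) N)))
  allNonZeroᶜ-applyUpTo v N v≉0 =
    ≡.subst NonZero (≡.sym (productᶜ-encList distanceFrom0ᶜ (applyUpTo (⌜_⌝ ∘ v) N) []))
            (product≢0 (map⁺ (applyUpTo⁺₂ (⌜_⌝ ∘ v) N λ i → ℕ.≢-nonZero (v≉0 i ∘ ⌜⌝-injective ∘ ∣m-n∣≡0⇒m≡n))))

  assignment-applyUpTo : ∀ (v : ℕ → Carrier) N i → i ℕ.< N → assignment (encList (applyUpTo (⌜_⌝ ∘ v) N)) i ≈ v i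
  assignment-applyUpTo v N i i<N = ≈-trans (reflexive (≡.cong ⌞_⌟ value-i)) (⌞⌜⌝⌟ (v i))
    where
    value-i : valueᶜ i (encList (applyUpTo (⌜_⌝ ∘ v) N)) ≡ ⌜ v i ⌝
    value-i = ≡.trans (valueᶜ-< (applyUpTo (⌜_⌝ ∘ v) N) i i<length) (applyUpTo-‼ (⌜_⌝ ∘ v) i<N)
      where i<length = ≡.subst (i ℕ.<_) (≡.sym (length-applyUpTo (⌜_⌝ ∘ v) N)) i<N

  assignment-nonZero : ¬ 1# ≈ 0# → ∀ m → NonZero (allNonZeroᶜ m) → ∀ i → ¬ assignment m i ≈ 0#
  assignment-nonZero 1≉0 m allNonZero i with l , ≡.refl ← encList-surjective m | i <? length l
  ... | yes i<l = λ ≈0 → ℕ.≢-nonZero⁻¹ _ {{All-‼ entries≉0 i<l}}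
                             (≡.trans (≡.cong (λ k → ∣ k - ⌜ 0# ⌝ ∣) (entry≡0 ≈0)) (∣n-n∣≡0 ⌜ 0# ⌝))
    where
    entries≉0 : All (λ x → NonZero ∣ x - ⌜ 0# ⌝ ∣) l
    entries≉0 = map⁻ (product≢0⁻¹ (map _ l) {{≡.subst NonZero (productᶜ-encList distanceFrom0ᶜ l []) allNonZero}})
    entry≡0 : assignment (encList l) i ≈ 0# → l ‼ i ≡ ⌜ 0# ⌝
    entry≡0 ≈0 = ≡.trans (≡.sym (valueᶜ-< l i i<l)) (≡.trans (≡.sym (⌜⌞⌟⌝ _)) (⌜⌝-cong ≈0))
  ... | no  i≮l = λ ≈0 → 1≉0 (≈-trans (≈-sym (⌞⌜⌝⌟ 1#)) (≈-trans (reflexive (≡.cong ⌞_⌟ value-i)) ≈0))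
    where
    value-i : ⌜ 1# ⌝ ≡ valueᶜ i (encList l)
    value-i = ≡.sym (valueᶜ-≥ l i (≮⇒≥ i≮l))

  isRootᶜ : ℕ → ℕ → ℕ
  isRootᶜ n m = is-zero ∣ evalPolyᶜ n m - ⌜ 0# ⌝ ∣

  isRootᶜ-encPoly : ∀ p m → ⟦ p ⟧ assignment m ≈ 0# → NonZero (isRootᶜ (encPoly R φ p) m)
  isRootᶜ-encPoly p m root = ≡.subst NonZero (≡.sym (≡.cong is-zero distance≡0)) _
    where
    distance≡0 : ∣ evalPolyᶜ (encPoly R φ p) m - ⌜ 0# ⌝ ∣ ≡ 0
    distance≡0 = ≡.trans (≡.cong (λ k → ∣ k - ⌜ 0# ⌝ ∣) (≡.trans (evalPolyᶜ-encPoly p m) (⌜⌝-cong root)))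
                         (∣n-n∣≡0 ⌜ 0# ⌝)

  isRootᶜ-nonZero : ∀ p m → NonZero (isRootᶜ (encPoly R φ p) m) → ⟦ p ⟧ assignment m ≈ 0#
  isRootᶜ-nonZero p m isRoot = ⌜⌝-injective (≡.trans (≡.sym (evalPolyᶜ-encPoly p m))
                                                      (∣m-n∣≡0⇒m≡n (is-zero-nonZero _ isRoot)))

  rootCheckᶜ : ℕ → ℕ → ℕ
  rootCheckᶜ n m = isPolyᶜ n ℕ.* allNonZeroᶜ m ℕ.* isRootᶜ n m

  rootCheckᶜ-computable : Computable² rootCheckᶜ
  rootCheckᶜ-computable = computable²
    (call² *-computable
      (call² *-computable (call¹ isPolyᶜ-computable x₀) (call¹ allNonZeroᶜ-computable x₁))
      (call¹ is-zero-computable (call² ∣-∣-computable (call² evalPolyᶜ-computable x₀ x₁) (const-computable ⌜ 0# ⌝))))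

  rootCheckᶜ-complete : ∀ n → P₁ R φ n → ∃ λ m → NonZero (rootCheckᶜ n m)
  rootCheckᶜ-complete _ (p , ≡.refl , v , v≉0 , root) =
    m , m*n≢0 (isPolyᶜ n ℕ.* allNonZeroᶜ m) (isRootᶜ n m)
          {{m*n≢0 (isPolyᶜ n) (allNonZeroᶜ m) {{isPolyᶜ-encPoly p}} {{allNonZeroᶜ-applyUpTo v N v≉0}}}}
          {{isRootᶜ-encPoly p m root′}}
    where
    n = encPoly R φ p
    N = arity p
    m = encList (applyUpTo (⌜_⌝ ∘ v) N)
    root′ : ⟦ p ⟧ assignment m ≈ 0#
    root′ = ≈-trans (⟦⟧-local p (assignment m) v (assignment-applyUpTo v N)) root

  rootCheckᶜ-nonZero : ∀ n m → NonZero (rootCheckᶜ n m) →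
                       NonZero (isPolyᶜ n) × NonZero (allNonZeroᶜ m) × NonZero (isRootᶜ n m)
  rootCheckᶜ-nonZero n m check =
    m*n≢0⇒m≢0 (isPolyᶜ n) {{first-two}} , m*n≢0⇒n≢0 (isPolyᶜ n) {{first-two}} ,
    m*n≢0⇒n≢0 (isPolyᶜ n ℕ.* allNonZeroᶜ m) {{check}}
    where
    first-two : NonZero (isPolyᶜ n ℕ.* allNonZeroᶜ m)
    first-two = m*n≢0⇒m≢0 (isPolyᶜ n ℕ.* allNonZeroᶜ m) {{check}}

  rootCheckᶜ-sound : ¬ 1# ≈ 0# → ∀ n m → NonZero (rootCheckᶜ n m) → P₁ R φ n
  rootCheckᶜ-sound 1≉0 n m check
    with isPoly , allNonZero , isRoot ← rootCheckᶜ-nonZero n m check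
    with p , ≡.refl ← isPolyᶜ-nonZero n isPoly
    = p , ≡.refl , assignment m , assignment-nonZero 1≉0 m allNonZero , isRootᶜ-nonZero p m isRoot

  P₁-Σ⁰₁ : ¬ 1# ≈ 0# → Σ⁰₁ (P₁ R φ)
  P₁-Σ⁰₁ 1≉0 = Σ⁰₁-by-checker rootCheckᶜ-computable λ n →
    mk⇔ (rootCheckᶜ-complete n) (λ { (m , check) → rootCheckᶜ-sound 1≉0 n m check })

module VariableSplitting {c ℓ : Level} (R : CommutativeRing c ℓ) (φ : Numbering R) where
  open CommutativeRing R hiding (zero) renaming (refl to ≈-refl; sym to ≈-sym; trans to ≈-trans)
  open PolynomialCodes R φ
  open import Data.Nat as ℕ using (ℕ; zero; suc)
  open import Data.List using (List; []; _∷_; map; _++_; concatMap; foldr)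
  open import Data.Product using (_×_; _,_; map₁; map₂)
  open import Function using (_∘_)
  open import Relation.Binary.PropositionalEquality as ≡ using (_≡_)
  open import Relation.Binary.Reasoning.Setoid setoid

  variable
    a b : Level
    A : Set a
    B : Set b

  sumOver : (A → Carrier) → List A → Carrier
  sumOver f = foldr (λ x acc → f x + acc) 0#

  sumOver-++ : ∀ (f : A → Carrier) xs ys → sumOver f (xs ++ ys) ≈ sumOver f xs + sumOver f ys
  sumOver-++ f []       ys = ≈-sym (+-identityˡ _)
  sumOver-++ f (x ∷ xs) ys = ≈-trans (+-cong ≈-refl (sumOver-++ f xs ys)) (≈-sym (+-assoc _ _ _))

  sumOver-cong : ∀ {f g : A → Carrier} → (∀ x → f x ≈ g x) → ∀ xs → sumOver f xs ≈ sumOver g xs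
  sumOver-cong f≈g []       = ≈-refl
  sumOver-cong f≈g (x ∷ xs) = +-cong (f≈g x) (sumOver-cong f≈g xs)

  sumOver-*ˡ : ∀ k (f : A → Carrier) xs → sumOver (λ x → k * f x) xs ≈ k * sumOver f xs
  sumOver-*ˡ k f []       = ≈-sym (zeroʳ k)
  sumOver-*ˡ k f (x ∷ xs) = ≈-trans (+-cong ≈-refl (sumOver-*ˡ k f xs)) (≈-sym (distribˡ k _ _))

  sumOver-*ʳ : ∀ k (f : A → Carrier) xs → sumOver (λ x → f x * k) xs ≈ sumOver f xs * k
  sumOver-*ʳ k f []       = ≈-sym (zeroˡ k)
  sumOver-*ʳ k f (x ∷ xs) = ≈-trans (+-cong ≈-refl (sumOver-*ʳ k f xs)) (≈-sym (distribʳ k _ _))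

  sumOver-map : ∀ (f : B → Carrier) (g : A → B) xs → sumOver f (map g xs) ≡ sumOver (f ∘ g) xs
  sumOver-map f g []       = ≡.refl
  sumOver-map f g (x ∷ xs) = ≡.cong (f (g x) +_) (sumOver-map f g xs)

  sumOver-concatMap : ∀ (f : B → Carrier) (g : A → List B) xs →
                      sumOver f (concatMap g xs) ≈ sumOver (sumOver f ∘ g) xs
  sumOver-concatMap f g []       = ≈-refl
  sumOver-concatMap f g (x ∷ xs) =
    ≈-trans (sumOver-++ f (g x) (concatMap g xs)) (+-cong ≈-refl (sumOver-concatMap f g xs))

  infixr 8 _^_
  _^_ : Carrier → ℕ → Carrier
  _^_ = pow R φ

  -- (a , b) stands for the term u^a t^b of (u + t)^k expanded without collecting terms

  splittings : ℕ → List (ℕ × ℕ)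
  splittings zero    = (0 , 0) ∷ []
  splittings (suc k) = map (map₁ suc) (splittings k) ++ map (map₂ suc) (splittings k)

  splitTerm : Carrier → Carrier → ℕ × ℕ → Carrier
  splitTerm u t (a , b) = u ^ a * t ^ b

  binomial : ∀ u t k → sumOver (splitTerm u t) (splittings k) ≈ (u + t) ^ k
  binomial u t zero    = ≈-trans (+-identityʳ _) (*-identityˡ _)
  binomial u t (suc k) = begin
    sumOver term (map (map₁ suc) ss ++ map (map₂ suc) ss)
      ≈⟨ sumOver-++ term (map (map₁ suc) ss) (map (map₂ suc) ss) ⟩
    sumOver term (map (map₁ suc) ss) + sumOver term (map (map₂ suc) ss)
      ≡⟨ ≡.cong₂ _+_ (sumOver-map term _ ss) (sumOver-map term _ ss) ⟩
    sumOver (term ∘ map₁ suc) ss + sumOver (term ∘ map₂ suc) ss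
      ≈⟨ +-cong (sumOver-cong (λ { (a , b) → *-assoc u _ _ }) ss)
                (sumOver-cong (λ { (a , b) → x*[y*z]≈y*[x*z] (u ^ a) t _ }) ss) ⟩
    sumOver (λ ab → u * term ab) ss + sumOver (λ ab → t * term ab) ss
      ≈⟨ +-cong (sumOver-*ˡ u term ss) (sumOver-*ˡ t term ss) ⟩
    u * sumOver term ss + t * sumOver term ss
      ≈⟨ ≈-sym (distribʳ _ u t) ⟩
    (u + t) * sumOver term ss
      ≈⟨ *-cong ≈-refl (binomial u t k) ⟩
    (u + t) * (u + t) ^ k ∎
    where
    ss = splittings k
    term = splitTerm u t
    x*[y*z]≈y*[x*z] : ∀ x y z → x * (y * z) ≈ y * (x * z)
    x*[y*z]≈y*[x*z] x y z = ≈-trans (≈-sym (*-assoc x y z)) (≈-trans (*-cong (*-comm x y) ≈-refl) (*-assoc y x z))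

  double : ℕ → ℕ
  double zero    = zero
  double (suc i) = suc (suc (double i))

  merge : (ℕ → Carrier) → ℕ → Carrier
  merge w i = w (double i) + w (suc (double i))

  prepend : List ℕ → ℕ × ℕ → List ℕ
  prepend r (a , b) = a ∷ b ∷ r

  splitExponents : List ℕ → List (List ℕ)
  splitExponents []       = [] ∷ []
  splitExponents (k ∷ ks) = concatMap (λ r → map (prepend r) (splittings k)) (splitExponents ks)

  evalMono-splitExponents : ∀ w j es → sumOver (evalMono R φ w (double j)) (splitExponents es)
                                       ≈ evalMono R φ (merge w) j es
  evalMono-splitExponents w j []       = +-identityʳ _
  evalMono-splitExponents w j (k ∷ ks) = begin
    sumOver M₀ (concatMap (λ r → map (prepend r) ss) E)
      ≈⟨ sumOver-concatMap M₀ (λ r → map (prepend r) ss) E ⟩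
    sumOver (λ r → sumOver M₀ (map (prepend r) ss)) E
      ≈⟨ sumOver-cong (λ r → reflexive (sumOver-map M₀ (prepend r) ss)) E ⟩
    sumOver (λ r → sumOver (M₀ ∘ prepend r) ss) E
      ≈⟨ sumOver-cong (λ r → sumOver-cong (λ { (a , b) → ≈-sym (*-assoc (u ^ a) (t ^ b) (M₂ r)) }) ss) E ⟩
    sumOver (λ r → sumOver (λ ab → splitTerm u t ab * M₂ r) ss) E
      ≈⟨ sumOver-cong (λ r → sumOver-*ʳ (M₂ r) (splitTerm u t) ss) E ⟩
    sumOver (λ r → sumOver (splitTerm u t) ss * M₂ r) E
      ≈⟨ sumOver-cong (λ r → *-cong (binomial u t k) ≈-refl) E ⟩
    sumOver (λ r → (u + t) ^ k * M₂ r) E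
      ≈⟨ sumOver-*ˡ ((u + t) ^ k) M₂ E ⟩
    (u + t) ^ k * sumOver M₂ E
      ≈⟨ *-cong ≈-refl (evalMono-splitExponents w (suc j) ks) ⟩
    (u + t) ^ k * evalMono R φ (merge w) (suc j) ks ∎
    where
    ss = splittings k
    E  = splitExponents ks
    u  = w (double j)
    t  = w (suc (double j))
    M₀ = evalMono R φ w (double j)
    M₂ = evalMono R φ w (double (suc j))

  splitMonomial : Carrier × List ℕ → Poly R φ
  splitMonomial (a , es) = map (a ,_) (splitExponents es)

  splitVariables : Poly R φ → Poly R φ
  splitVariables = concatMap splitMonomial

  monomialValue : (ℕ → Carrier) → Carrier × List ℕ → Carrier
  monomialValue w (a , es) = a * evalMono R φ w 0 es

  ⟦⟧-sumOver : ∀ p w → ⟦ p ⟧ w ≡ sumOver (monomialValue w) p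
  ⟦⟧-sumOver []             w = ≡.refl
  ⟦⟧-sumOver ((a , es) ∷ p) w = ≡.cong (a * evalMono R φ w 0 es +_) (⟦⟧-sumOver p w)

  ⟦splitVariables⟧ : ∀ p w → ⟦ splitVariables p ⟧ w ≈ ⟦ p ⟧ merge w
  ⟦splitVariables⟧ p w = begin
    ⟦ splitVariables p ⟧ w                                   ≡⟨ ⟦⟧-sumOver (splitVariables p) w ⟩
    sumOver (monomialValue w) (concatMap splitMonomial p)   ≈⟨ sumOver-concatMap (monomialValue w) splitMonomial p ⟩
    sumOver (sumOver (monomialValue w) ∘ splitMonomial) p   ≈⟨ sumOver-cong split-monomial p ⟩
    sumOver (monomialValue (merge w)) p                      ≡⟨ ≡.sym (⟦⟧-sumOver p (merge w)) ⟩
    ⟦ p ⟧ merge w                                            ∎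
    where
    split-monomial : ∀ m → sumOver (monomialValue w) (splitMonomial m) ≈ monomialValue (merge w) m
    split-monomial (a , es) = begin
      sumOver (monomialValue w) (map (a ,_) E)  ≡⟨ sumOver-map (monomialValue w) (a ,_) E ⟩
      sumOver (λ e → a * evalMono R φ w 0 e) E  ≈⟨ sumOver-*ˡ a (evalMono R φ w 0) E ⟩
      a * sumOver (evalMono R φ w 0) E          ≈⟨ *-cong ≈-refl (evalMono-splitExponents w 0 es) ⟩
      a * evalMono R φ (merge w) 0 es           ∎
      where E = splitExponents es

module VariableSplittingOnCodes {c ℓ : Level} (R : CommutativeRing c ℓ) (φ : Numbering R) where
  open CommutativeRing R hiding (zero) renaming (refl to ≈-refl; sym to ≈-sym; trans to ≈-trans)
  open Computability
  open Arithmetic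
  open ListCode
  open Folds
  open PolynomialCodes R φ
  open VariableSplitting R φ
  open import Data.Nat as ℕ using (ℕ; zero; suc)
  open import Data.Fin using (zero; suc)
  open import Data.Vec using ([]; _∷_; lookup)
  open import Data.List using (List; []; _∷_; map; _++_; concatMap; foldr)
  open import Data.List.Properties using (map-++; map-∘; map-concatMap)
  open import Data.Product using (_,_; map₁; map₂)
  open import Function using (_∘_)
  open import Relation.Binary.PropositionalEquality as ≡ using (_≡_)

  incrementFirstᶜ : Fn 1
  incrementFirstᶜ ys = consᶜ (suc (headᶜ (lookup ys zero))) (tailᶜ (lookup ys zero))

  incrementSecondᶜ : Fn 1
  incrementSecondᶜ ys = consᶜ (headᶜ (lookup ys zero))
                              (consᶜ (suc (headᶜ (tailᶜ (lookup ys zero)))) (tailᶜ (tailᶜ (lookup ys zero))))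

  splittingsᶜ : ℕ → ℕ → ℕ
  splittingsᶜ zero    r = consᶜ (consᶜ 0 (consᶜ 0 r)) 0
  splittingsᶜ (suc k) r =
    appendᶜ (mapᶜ incrementFirstᶜ (splittingsᶜ k r ∷ [])) (mapᶜ incrementSecondᶜ (splittingsᶜ k r ∷ []))

  splittingsᶜ-computable : Computable² splittingsᶜ
  splittingsᶜ-computable = computable² (prec-computable base step _ (λ _ → ≡.refl) (λ _ _ → ≡.refl))
    where
    base : Computable {1} (λ xs → splittingsᶜ 0 (lookup xs zero))
    base = call² consᶜ-computable
             (call² consᶜ-computable (const-computable 0) (call² consᶜ-computable (const-computable 0) x₀))
             (const-computable 0)
    incrementFirst : Computable incrementFirstᶜ
    incrementFirst = call² consᶜ-computable (call¹ suc-computable (call¹ headᶜ-computable x₀))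
                                            (call¹ tailᶜ-computable x₀)
    incrementSecond : Computable incrementSecondᶜ
    incrementSecond = call² consᶜ-computable (call¹ headᶜ-computable x₀)
      (call² consᶜ-computable (call¹ suc-computable (call¹ headᶜ-computable (call¹ tailᶜ-computable x₀)))
                              (call¹ tailᶜ-computable (call¹ tailᶜ-computable x₀)))
    step : Computable {3} (λ ys → appendᶜ (mapᶜ incrementFirstᶜ (lookup ys (suc zero) ∷ []))
                                          (mapᶜ incrementSecondᶜ (lookup ys (suc zero) ∷ [])))
    step = call² appendᶜ-computable (mapᶜ-computable incrementFirstᶜ incrementFirst ∘* x₁ ∷* []*)
                                    (mapᶜ-computable incrementSecondᶜ incrementSecond ∘* x₁ ∷* []*)

  incrementFirstᶜ-prepend : ∀ r ab → incrementFirstᶜ (encList (prepend r ab) ∷ [])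
                                     ≡ encList (prepend r (map₁ suc ab))
  incrementFirstᶜ-prepend r (a , b)
    rewrite headᶜ-consᶜ a (encList (b ∷ r)) | tailᶜ-consᶜ a (encList (b ∷ r))
    = ≡.refl

  incrementSecondᶜ-prepend : ∀ r ab → incrementSecondᶜ (encList (prepend r ab) ∷ [])
                                      ≡ encList (prepend r (map₂ suc ab))
  incrementSecondᶜ-prepend r (a , b)
    rewrite headᶜ-consᶜ a (encList (b ∷ r)) | tailᶜ-consᶜ a (encList (b ∷ r))
          | headᶜ-consᶜ b (encList r)       | tailᶜ-consᶜ b (encList r)
    = ≡.refl

  splittingsᶜ-encList : ∀ k r → splittingsᶜ k (encList r) ≡ encList (map (encList ∘ prepend r) (splittings k))
  splittingsᶜ-encList zero    r = ≡.refl
  splittingsᶜ-encList (suc k) r = begin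
    both (splittingsᶜ k (encList r))
      ≡⟨ ≡.cong both (splittingsᶜ-encList k r) ⟩
    both (encList (map code ss))
      ≡⟨ ≡.cong₂ appendᶜ (mapᶜ-encList incrementFirstᶜ code (code ∘ map₁ suc) [] ss (incrementFirstᶜ-prepend r))
                         (mapᶜ-encList incrementSecondᶜ code (code ∘ map₂ suc) [] ss (incrementSecondᶜ-prepend r)) ⟩
    appendᶜ (encList (map (code ∘ map₁ suc) ss)) (encList (map (code ∘ map₂ suc) ss))
      ≡⟨ appendᶜ-encList (map (code ∘ map₁ suc) ss) (map (code ∘ map₂ suc) ss) ⟩
    encList (map (code ∘ map₁ suc) ss ++ map (code ∘ map₂ suc) ss)
      ≡⟨ ≡.cong encList (≡.cong₂ _++_ (map-∘ {g = code} {f = map₁ suc} ss) (map-∘ {g = code} {f = map₂ suc} ss)) ⟩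
    encList (map code (map (map₁ suc) ss) ++ map code (map (map₂ suc) ss))
      ≡⟨ ≡.cong encList (≡.sym (map-++ code (map (map₁ suc) ss) (map (map₂ suc) ss))) ⟩
    encList (map code (map (map₁ suc) ss ++ map (map₂ suc) ss)) ∎
    where
    open ≡.≡-Reasoning
    ss = splittings k
    code = encList ∘ prepend r
    both : ℕ → ℕ
    both c = appendᶜ (mapᶜ incrementFirstᶜ (c ∷ [])) (mapᶜ incrementSecondᶜ (c ∷ []))

  splitStepᶜ : Fn 2
  splitStepᶜ ys = splittingsᶜ (lookup ys (suc zero)) (lookup ys zero)

  splitExponentsᶜ : ℕ → ℕ
  splitExponentsᶜ es =
    foldᶜ (λ ys → concatMapᶜ splitStepᶜ (lookup ys (suc (suc zero)) ∷ lookup ys (suc zero) ∷ []))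
          (λ _ → encList (encList [] ∷ [])) (es ∷ [])

  splitExponentsᶜ-computable : Computable¹ splitExponentsᶜ
  splitExponentsᶜ-computable = computable¹ (computable-≗ (λ { (es ∷ []) → ≡.refl })
    (foldᶜ-computable
      (concatMapᶜ-computable splitStepᶜ (call² splittingsᶜ-computable x₁ x₀) ∘* x₂ ∷* x₁ ∷* []*)
      (const-computable (encList (encList [] ∷ [])))))

  splitExponentsᶜ-encList : ∀ es → splitExponentsᶜ (encList es) ≡ encList (map encList (splitExponents es))
  splitExponentsᶜ-encList es =
    ≡.trans (foldᶜ-encList _ _ es []) (≡.trans (ifoldr-ignoring-index _ _ 0 es) (foldr-splitStep es))
    where
    step : ℕ → ℕ → ℕ
    step k acc = concatMapᶜ splitStepᶜ (acc ∷ k ∷ [])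
    foldr-splitStep : ∀ es → foldr step (encList (encList [] ∷ [])) es ≡ encList (map encList (splitExponents es))
    foldr-splitStep []       = ≡.refl
    foldr-splitStep (k ∷ ks) = begin
      step k (foldr step (encList (encList [] ∷ [])) ks)
        ≡⟨ ≡.cong (step k) (foldr-splitStep ks) ⟩
      concatMapᶜ splitStepᶜ (encList (map encList E) ∷ k ∷ [])
        ≡⟨ concatMapᶜ-encList splitStepᶜ encList (map encList ∘ λ r → map (prepend r) ss) (k ∷ []) E
             (λ r → ≡.trans (splittingsᶜ-encList k r) (≡.cong encList (map-∘ {g = encList} {f = prepend r} ss))) ⟩
      encList (concatMap (map encList ∘ λ r → map (prepend r) ss) E)
        ≡⟨ ≡.cong encList (≡.sym (map-concatMap encList (λ r → map (prepend r) ss) E)) ⟩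
      encList (map encList (concatMap (λ r → map (prepend r) ss) E)) ∎
      where
      open ≡.≡-Reasoning
      ss = splittings k
      E  = splitExponents ks

  withCoefficientᶜ : Fn 2
  withCoefficientᶜ ys = consᶜ (lookup ys (suc zero)) (lookup ys zero)

  splitMonomialᶜ : ℕ → ℕ
  splitMonomialᶜ m = mapᶜ withCoefficientᶜ (splitExponentsᶜ (tailᶜ m) ∷ headᶜ m ∷ [])

  splitMonomialᶜ-computable : Computable¹ splitMonomialᶜ
  splitMonomialᶜ-computable = computable¹
    (mapᶜ-computable withCoefficientᶜ (call² consᶜ-computable x₁ x₀)
       ∘* call¹ splitExponentsᶜ-computable (call¹ tailᶜ-computable x₀) ∷* call¹ headᶜ-computable x₀ ∷* []*)

  splitMonomialᶜ-monomialCode : ∀ m → splitMonomialᶜ (monomialCode m) ≡ encList (map monomialCode (splitMonomial m))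
  splitMonomialᶜ-monomialCode (a , es)
    rewrite tailᶜ-consᶜ ⌜ a ⌝ (encList es) | headᶜ-consᶜ ⌜ a ⌝ (encList es) | splitExponentsᶜ-encList es
    = ≡.trans (mapᶜ-encList withCoefficientᶜ encList (monomialCode ∘ (a ,_)) (⌜ a ⌝ ∷ []) E (λ _ → ≡.refl))
              (≡.cong encList (map-∘ {g = monomialCode} {f = a ,_} E))
    where E = splitExponents es

  splitVariablesᶜ : ℕ → ℕ
  splitVariablesᶜ n = concatMapᶜ (λ ys → splitMonomialᶜ (lookup ys zero)) (n ∷ [])

  splitVariablesᶜ-computable : Computable¹ splitVariablesᶜ
  splitVariablesᶜ-computable = computable¹ (computable-≗ (λ { (n ∷ []) → ≡.refl })
    (concatMapᶜ-computable (λ ys → splitMonomialᶜ (lookup ys zero)) (call¹ splitMonomialᶜ-computable x₀)))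

  splitVariablesᶜ-encPoly : ∀ p → splitVariablesᶜ (encPoly R φ p) ≡ encPoly R φ (splitVariables p)
  splitVariablesᶜ-encPoly p = begin
    splitVariablesᶜ (encPoly R φ p)
      ≡⟨ ≡.cong splitVariablesᶜ (encPoly-encList p) ⟩
    splitVariablesᶜ (encList (map monomialCode p))
      ≡⟨ concatMapᶜ-encList (λ ys → splitMonomialᶜ (lookup ys zero)) monomialCode (map monomialCode ∘ splitMonomial)
                            [] p splitMonomialᶜ-monomialCode ⟩
    encList (concatMap (map monomialCode ∘ splitMonomial) p)
      ≡⟨ ≡.cong encList (≡.sym (map-concatMap monomialCode splitMonomial p)) ⟩
    encList (map monomialCode (splitVariables p))
      ≡⟨ ≡.sym (encPoly-encList (splitVariables p)) ⟩
    encPoly R φ (splitVariables p) ∎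
    where open ≡.≡-Reasoning

module Reduction {c ℓ : Level} (R : CommutativeRing c ℓ) (φ : Numbering R) where
  open CommutativeRing R hiding (zero) renaming (refl to ≈-refl; sym to ≈-sym; trans to ≈-trans)
  open import Algebra.Properties.Ring ring using (//-rightDividesˡ; x∙y⁻¹≈ε⇒x≈y)
  open Computability
  open Arithmetic
  open ListCode
  open PolynomialCodes R φ
  open VariableSplitting R φ
  open VariableSplittingOnCodes R φ
  open import Data.Nat as ℕ using (ℕ; zero; suc; s≤s)
  open import Data.Nat.Properties using (<⇒≢; m≤m+n; m≤n+m)
  open import Data.Product using (_,_)
  open import Function using (_∘_)
  open import Function.Bundles using (_⇔_; mk⇔)
  open import Relation.Nullary using (¬_; yes; no; contradiction)
  open import Relation.Binary.PropositionalEquality as ≡ using (_≡_)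
  open import Relation.Binary.Reasoning.Setoid setoid

  reductionᶜ : ℕ → ℕ
  reductionᶜ n = if-zero (isPolyᶜ n) n (splitVariablesᶜ n)

  reductionᶜ-computable : Computable¹ reductionᶜ
  reductionᶜ-computable = computable¹ (call³ if-zero-computable (call¹ isPolyᶜ-computable x₀) x₀
                                                                (call¹ splitVariablesᶜ-computable x₀))

  reductionᶜ-encPoly : ∀ p → reductionᶜ (encPoly R φ p) ≡ encPoly R φ (splitVariables p)
  reductionᶜ-encPoly p =
    ≡.trans (if-zero-≢0 _ _ (ℕ.≢-nonZero⁻¹ _ {{isPolyᶜ-encPoly p}})) (splitVariablesᶜ-encPoly p)

  reductionᶜ-nonPoly : ∀ {n} → isPolyᶜ n ≡ 0 → reductionᶜ n ≡ n
  reductionᶜ-nonPoly {n} notPoly = ≡.cong (λ t → if-zero t n (splitVariablesᶜ n)) notPoly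

  interleave : (ℕ → Carrier) → (ℕ → Carrier) → ℕ → Carrier
  interleave a b zero          = a 0
  interleave a b (suc zero)    = b 0
  interleave a b (suc (suc j)) = interleave (a ∘ suc) (b ∘ suc) j

  merge-interleave : ∀ a b i → merge (interleave a b) i ≡ a i + b i
  merge-interleave a b zero    = ≡.refl
  merge-interleave a b (suc i) = merge-interleave (a ∘ suc) (b ∘ suc) i

  interleave-≉0 : ∀ a b → (∀ i → ¬ a i ≈ 0#) → (∀ i → ¬ b i ≈ 0#) → ∀ j → ¬ interleave a b j ≈ 0#
  interleave-≉0 a b a≉0 b≉0 zero          = a≉0 0
  interleave-≉0 a b a≉0 b≉0 (suc zero)    = b≉0 0
  interleave-≉0 a b a≉0 b≉0 (suc (suc j)) = interleave-≉0 (a ∘ suc) (b ∘ suc) (a≉0 ∘ suc) (b≉0 ∘ suc) j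

  -- Its code exceeds those of 0# and of x, so x = (x - offset x) + offset x with both summands nonzero.
  offset : Carrier → Carrier
  offset x = ⌞ suc (⌜ 0# ⌝ ℕ.+ ⌜ x ⌝) ⌟

  ⌜offset⌝ : ∀ x → ⌜ offset x ⌝ ≡ suc (⌜ 0# ⌝ ℕ.+ ⌜ x ⌝)
  ⌜offset⌝ x = ⌜⌞⌟⌝ _

  offset-≉0 : ∀ x → ¬ offset x ≈ 0#
  offset-≉0 x offset≈0 = <⇒≢ (s≤s (m≤m+n ⌜ 0# ⌝ ⌜ x ⌝)) (≡.trans (≡.sym (⌜⌝-cong offset≈0)) (⌜offset⌝ x))

  x-offset-≉0 : ∀ x → ¬ x - offset x ≈ 0#
  x-offset-≉0 x x-offset≈0 =
    <⇒≢ (s≤s (m≤n+m ⌜ x ⌝ ⌜ 0# ⌝)) (≡.trans (⌜⌝-cong (x∙y⁻¹≈ε⇒x≈y x (offset x) x-offset≈0)) (⌜offset⌝ x))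

  P₀→P₁∘reductionᶜ : ∀ n → P₀ R φ n → P₁ R φ (reductionᶜ n)
  P₀→P₁∘reductionᶜ _ (p , ≡.refl , v , root) =
    splitVariables p , ≡.sym (reductionᶜ-encPoly p) , w ,
    interleave-≉0 _ _ (x-offset-≉0 ∘ v) (offset-≉0 ∘ v) , split-root
    where
    w = interleave (λ i → v i - offset (v i)) (offset ∘ v)
    merge-w≈v : ∀ i → merge w i ≈ v i
    merge-w≈v i = ≈-trans (reflexive (merge-interleave _ _ i)) (//-rightDividesˡ (offset (v i)) (v i))
    split-root : ⟦ splitVariables p ⟧ w ≈ 0#
    split-root = begin
      ⟦ splitVariables p ⟧ w  ≈⟨ ⟦splitVariables⟧ p w ⟩
      ⟦ p ⟧ merge w           ≈⟨ ⟦⟧-local p (merge w) v (λ i _ → merge-w≈v i) ⟩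
      ⟦ p ⟧ v                 ≈⟨ root ⟩
      0#                      ∎

  P₁∘reductionᶜ→P₀ : ∀ n → P₁ R φ (reductionᶜ n) → P₀ R φ n
  P₁∘reductionᶜ→P₀ n (q , q-code , w , _ , root) with isPolyᶜ n ℕ.≟ 0
  ... | yes notPoly =
    contradiction (≡.trans (≡.cong isPolyᶜ (≡.trans q-code (reductionᶜ-nonPoly notPoly))) notPoly)
                  (ℕ.≢-nonZero⁻¹ _ {{isPolyᶜ-encPoly q}})
  ... | no isPoly with p , ≡.refl ← isPolyᶜ-nonZero n (ℕ.≢-nonZero isPoly) = p , ≡.refl , merge w , merged-root
    where
    same-code : encPoly R φ (splitVariables p) ≡ encPoly R φ q
    same-code = ≡.trans (≡.sym (reductionᶜ-encPoly p)) (≡.sym q-code)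
    merged-root : ⟦ p ⟧ merge w ≈ 0#
    merged-root = begin
      ⟦ p ⟧ merge w           ≈⟨ ⟦splitVariables⟧ p w ⟨
      ⟦ splitVariables p ⟧ w  ≈⟨ ⟦⟧-encPoly (splitVariables p) q w same-code ⟩
      ⟦ q ⟧ w                 ≈⟨ root ⟩
      0#                      ∎

  P₀⇔P₁∘reductionᶜ : ∀ n → P₀ R φ n ⇔ P₁ R φ (reductionᶜ n)
  P₀⇔P₁∘reductionᶜ n = mk⇔ (P₀→P₁∘reductionᶜ n) (P₁∘reductionᶜ→P₀ n)

-- of the integral domain hypothesis only 1 ≉ 0 is used
lemma2p25 : ∀ {c ℓ : Level} (R : CommutativeRing c ℓ) (φ : Numbering R) →
            IsIntegralDomain R → InducedOpsComputable R φ →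
            Σ⁰₁-complete (P₀ R φ) → Σ⁰₁-complete (P₁ R φ)
lemma2p25 R φ (1≉0 , _) ops (_ , P₀∉Π⁰₁) =
  P₁-Σ⁰₁ 1≉0 , λ P₁∈Π⁰₁ → P₀∉Π⁰₁ (Π⁰₁-reduce reductionᶜ-computable P₀⇔P₁∘reductionᶜ P₁∈Π⁰₁)
  where
  open ArithmeticalHierarchy
  open RootChecking R φ ops
  open Reduction R φ
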